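{- Let $n\geq 1$. For every formula $\varphi$ of the modal language $\mathcal{L}_\Box$ containing at most $n$ distinct variables, the following are equivalent: (i) $\mathbf{FIX}\Vdash\varphi$; (ii) $\mathbf{S5[Con,Ground,Min_n]}\vdash\varphi$.
   Context: Kripke fixed points. Let $\mathcal{L}_T$ be the first-order language of arithmetic augmented with a unary predicate $\mathsf{True}$, with a standard Gödel numbering $\varphi\mapsto\ulcorner\varphi\urcorner$. Sentences are evaluated in strong Kleene three-valued logic $\mathsf{K3}$ with values \textsc{true}, \textsc{false}, \textsc{neither}: $\varphi\wedge\psi$ is true iff both are true, false iff at least one is false, neither otherwise; $\neg\varphi$ is true iff $\varphi$ is false, false iff $\varphi$ is true, neither otherwise; $\forall x\,\varphi(x)$ is true iff every instance $\varphi(\bar n)$ is true, false iff some instance is false, neither otherwise (other connectives defined as usual). For a set $S\subseteq\mathbb{N}$ let $\mathbb{N}_S$ be the three-valued model interpreting the arithmetic vocabulary standardly (bivalently) and making $\mathsf{True}(n)$ true iff $n\in S$, false iff $n$ is not the code of a sentence or $n=\ulcorner\varphi\urcorner$ with $\ulcorner\neg\varphi\urcorner\in S$, and neither otherwise. A fixed point is a set $S$ of codes of $\mathcal{L}_T$ sentences such that $S=\{\ulcorner\varphi\urcorner:\varphi\text{ is true in }\mathbb{N}_S\}$ and there is no sentence $\varphi$ with both $\ulcorner\varphi\urcorner\in S$ and $\ulcorner\neg\varphi\urcorner\in S$. The value of a sentence in a fixed point $S$ is its value in $\mathbb{N}_S$. $\mathbf{FIX}$ denotes the set of all fixed points. Modal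 language and semantics. $\mathcal{L}_\Box$ has a countably infinite set of variables, one-place predicate symbols $T,F$, and formulas $\varphi::=T(x)\mid F(x)\mid\neg\varphi\mid(\varphi\wedge\varphi)\mid\Box\varphi$ (no quantifiers, no propositional variables); $\vee,\to,\leftrightarrow,\lozenge$ are the usual abbreviations, and $N(x)$ abbreviates $\neg T(x)\wedge\neg F(x)$. A realization $\star$ assigns to each variable $x$ an $\mathcal{L}_T$ sentence $x^\star$. For $w\in\mathbf{FIX}$: $w\Vdash_\star T(x)$ iff $x^\star$ is \textsc{true} in $w$; $w\Vdash_\star F(x)$ iff $x^\star$ is \textsc{false} in $w$; $\neg,\wedge$ are classical; $w\Vdash_\star\Box\varphi$ iff $v\Vdash_\star\varphi$ for every $v\in\mathbf{FIX}$. $\mathbf{FIX}\Vdash_\star\varphi$ means $w\Vdash_\star\varphi$ for all $w\in\mathbf{FIX}$; $\mathbf{FIX}\Vdash\varphi$ means $\mathbf{FIX}\Vdash_\star\varphi$ for every realization $\star$. Axiom systems. $\mathbf{S5}$ (in this signature) is the least set of $\mathcal{L}_\Box$ formulas containing all substitution instances of classical propositional tautologies and all instances of $\mathbf{K}$: $\Box(A\to B)\to(\Box A\to\Box B)$, $\mathbf{T}$: $\Box A\to A$, $\mathbf{5}$: $\lozenge A\to\Box\lozenge A$, and closed under modus ponens and necessitation (if $A$ is a theorem so is $\Box A$). $\mathbf{S5[Con,Ground,Min_n]}$ is obtained by adding as axioms, for all variables $x,x_1,\dots,x_n$ (not necessarily distinct): $\mathbf{Con}$: $\neg(T(x)\wedge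 F(x))$; $\mathbf{Ground}$: $(\lozenge T(x)\wedge\lozenge F(x))\to\lozenge N(x)$; $\mathbf{Min_n}$: $(\lozenge N(x_1)\wedge\dots\wedge\lozenge N(x_n))\to\lozenge(N(x_1)\wedge\dots\wedge N(x_n))$, and closing under the same rules. -}

module Defs where

open import Data.Nat using (ℕ; zero; suc; _+_; _*_)
open import Data.Fin using (Fin; toℕ)
open import Data.Bool using (Bool; true; false)
open import Data.Product using (Σ; _×_; _,_; proj₁)
open import Data.Vec using (Vec; []; _∷_; lookup)
open import Data.Empty using (⊥)
open import Relation.Binary.PropositionalEquality using (_≡_; _≢_)
open import Relation.Nullary using (¬_)

-- Formulas are in de Bruijn style: Fm k has k free variables; sentences are Fm 0.
-- Primitive connectives: ¬, ∧, ∀ (others are abbreviations).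

data Term (k : ℕ) : Set where
  var   : Fin k → Term k
  `zero : Term k
  `suc  : Term k → Term k
  _`+_  : Term k → Term k → Term k
  _`*_  : Term k → Term k → Term k

data Fm (k : ℕ) : Set where
  _`≡_  : Term k → Term k → Fm k
  `True : Term k → Fm k
  `¬    : Fm k → Fm k
  _`∧_  : Fm k → Fm k → Fm k
  `∀    : Fm (suc k) → Fm k

Sentence : Set
Sentence = Fm 0

evalT : ∀ {k} → Term k → Vec ℕ k → ℕ
evalT (var i)   ρ = lookup ρ i
evalT `zero     ρ = zero
evalT (`suc t)  ρ = suc (evalT t ρ)
evalT (t `+ u)  ρ = evalT t ρ + evalT u ρ
evalT (t `* u)  ρ = evalT t ρ * evalT u ρ

tri : ℕ → ℕ
tri zero    = zero
tri (suc n) = suc n + tri n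

pair : ℕ → ℕ → ℕ
pair a b = tri (a + b) + b

codeT : ∀ {k} → Term k → ℕ
codeT (var i)  = pair 0 (toℕ i)
codeT `zero    = pair 1 0
codeT (`suc t) = pair 2 (codeT t)
codeT (t `+ u) = pair 3 (pair (codeT t) (codeT u))
codeT (t `* u) = pair 4 (pair (codeT t) (codeT u))

code : ∀ {k} → Fm k → ℕ
code (t `≡ u)  = pair 0 (pair (codeT t) (codeT u))
code (`True t) = pair 1 (codeT t)
code (`¬ φ)    = pair 2 (code φ)
code (φ `∧ ψ)  = pair 3 (pair (code φ) (code ψ))
code (`∀ φ)    = pair 4 (code φ)

-- Strong Kleene evaluation in the model ℕ_S, S ⊆ ℕ given as ℕ → Bool.
-- Tr S φ ρ : φ is TRUE under assignment ρ; Fl S φ ρ : φ is FALSE.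
-- (NEITHER = neither of these.)  Quantifiers range over ℕ, which in the
-- standard model is the same as ranging over all numeral instances.

data Tr (S : ℕ → Bool) : ∀ {k} → Fm k → Vec ℕ k → Set
data Fl (S : ℕ → Bool) : ∀ {k} → Fm k → Vec ℕ k → Set

data Tr S where
  tr-≡    : ∀ {k} {t u : Term k} {ρ} → evalT t ρ ≡ evalT u ρ → Tr S (t `≡ u) ρ
  tr-True : ∀ {k} {t : Term k} {ρ} → S (evalT t ρ) ≡ true → Tr S (`True t) ρ
  tr-¬    : ∀ {k} {φ : Fm k} {ρ} → Fl S φ ρ → Tr S (`¬ φ) ρ
  tr-∧    : ∀ {k} {φ ψ : Fm k} {ρ} → Tr S φ ρ → Tr S ψ ρ → Tr S (φ `∧ ψ) ρ
  tr-∀    : ∀ {k} {φ : Fm (suc k)} {ρ} → (∀ m → Tr S φ (m ∷ ρ)) → Tr S (`∀ φ) ρ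

data Fl S where
  fl-≡       : ∀ {k} {t u : Term k} {ρ} → evalT t ρ ≢ evalT u ρ → Fl S (t `≡ u) ρ
  fl-nonSent : ∀ {k} {t : Term k} {ρ} →
               ¬ (Σ Sentence (λ φ → code φ ≡ evalT t ρ)) → Fl S (`True t) ρ
  fl-negIn   : ∀ {k} {t : Term k} {ρ} (φ : Sentence) →
               code φ ≡ evalT t ρ → S (code (`¬ φ)) ≡ true → Fl S (`True t) ρ
  fl-¬       : ∀ {k} {φ : Fm k} {ρ} → Tr S φ ρ → Fl S (`¬ φ) ρ
  fl-∧ˡ      : ∀ {k} {φ ψ : Fm k} {ρ} → Fl S φ ρ → Fl S (φ `∧ ψ) ρ
  fl-∧ʳ      : ∀ {k} {φ ψ : Fm k} {ρ} → Fl S ψ ρ → Fl S (φ `∧ ψ) ρ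
  fl-∀       : ∀ {k} {φ : Fm (suc k)} {ρ} (m : ℕ) → Fl S φ (m ∷ ρ) → Fl S (`∀ φ) ρ

TrueIn : (ℕ → Bool) → Sentence → Set
TrueIn S φ = Tr S φ []

FalseIn : (ℕ → Bool) → Sentence → Set
FalseIn S φ = Fl S φ []

IsFixedPoint : (ℕ → Bool) → Set
IsFixedPoint S =
  ((n : ℕ) → (S n ≡ true → Σ Sentence (λ φ → code φ ≡ n × TrueIn S φ))
           × (Σ Sentence (λ φ → code φ ≡ n × TrueIn S φ) → S n ≡ true))
  × ((φ : Sentence) → S (code φ) ≡ true → S (code (`¬ φ)) ≡ true → ⊥)

FIX : Set
FIX = Σ (ℕ → Bool) IsFixedPoint

data MF : Set where
  T  : ℕ → MF
  F  : ℕ → MF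
  ¬' : MF → MF
  _∧'_ : MF → MF → MF
  □  : MF → MF

_⇒'_ : MF → MF → MF
A ⇒' B = ¬' (A ∧' ¬' B)

_∨'_ : MF → MF → MF
A ∨' B = ¬' (¬' A ∧' ¬' B)

◇ : MF → MF
◇ A = ¬' (□ (¬' A))

N : ℕ → MF
N x = ¬' (T x) ∧' ¬' (F x)

-- Conjunction of a vector of formulas; only used for length ≥ 1
-- (the empty case, irrelevant for n ≥ 1, is a fixed tautology).
⊤' : MF
⊤' = ¬' (T 0 ∧' ¬' (T 0))

⋀ : ∀ {n} → Vec MF n → MF
⋀ []            = ⊤'
⋀ (a ∷ [])      = a
⋀ (a ∷ b ∷ as)  = a ∧' ⋀ (b ∷ as)

mapV : ∀ {n} {A B : Set} → (A → B) → Vec A n → Vec B n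
mapV f []       = []
mapV f (a ∷ as) = f a ∷ mapV f as

data Occurs (x : ℕ) : MF → Set where
  oT  : Occurs x (T x)
  oF  : Occurs x (F x)
  o¬  : ∀ {A} → Occurs x A → Occurs x (¬' A)
  o∧ˡ : ∀ {A B} → Occurs x A → Occurs x (A ∧' B)
  o∧ʳ : ∀ {A B} → Occurs x B → Occurs x (A ∧' B)
  o□  : ∀ {A} → Occurs x A → Occurs x (□ A)

data _∈V_ (x : ℕ) : ∀ {n} → Vec ℕ n → Set where
  here  : ∀ {n} {xs : Vec ℕ n} → x ∈V (x ∷ xs)
  there : ∀ {n y} {xs : Vec ℕ n} → x ∈V xs → x ∈V (y ∷ xs)

AtMostVars : ℕ → MF → Set
AtMostVars n φ = Σ (Vec ℕ n) (λ xs → ∀ x → Occurs x φ → x ∈V xs)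

Realization : Set
Realization = ℕ → Sentence

_,_⊩_ : Realization → FIX → MF → Set
⋆ , w ⊩ T x    = TrueIn (proj₁ w) (⋆ x)
⋆ , w ⊩ F x    = FalseIn (proj₁ w) (⋆ x)
⋆ , w ⊩ ¬' A   = ¬ (⋆ , w ⊩ A)
⋆ , w ⊩ (A ∧' B) = (⋆ , w ⊩ A) × (⋆ , w ⊩ B)
⋆ , w ⊩ □ A    = (v : FIX) → ⋆ , v ⊩ A

FIX⊩ : MF → Set
FIX⊩ A = (⋆ : Realization) (w : FIX) → ⋆ , w ⊩ A

-- Boolean evaluation treating T x, F x and □ A as propositional atoms;
-- A is a substitution instance of a classical tautology iff it evaluates
-- to true under every assignment to these atoms.
evalB : (MF → Bool) → MF → Bool
evalB v (T x)    = v (T x)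
evalB v (F x)    = v (F x)
evalB v (¬' A)   with evalB v A
... | true  = false
... | false = true
evalB v (A ∧' B) with evalB v A
... | true  = evalB v B
... | false = false
evalB v (□ A)    = v (□ A)

Tautology : MF → Set
Tautology A = (v : MF → Bool) → evalB v A ≡ true

data S5CGM (n : ℕ) : MF → Set where
  ax-taut   : ∀ {A} → Tautology A → S5CGM n A
  ax-K      : ∀ A B → S5CGM n (□ (A ⇒' B) ⇒' (□ A ⇒' □ B))
  ax-T      : ∀ A → S5CGM n (□ A ⇒' A)
  ax-5      : ∀ A → S5CGM n (◇ A ⇒' □ (◇ A))
  ax-Con    : ∀ x → S5CGM n (¬' (T x ∧' F x))
  ax-Ground : ∀ x → S5CGM n ((◇ (T x) ∧' ◇ (F x)) ⇒' ◇ (N x))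
  ax-Min    : (xs : Vec ℕ n) →
              S5CGM n (⋀ (mapV (λ x → ◇ (N x)) xs) ⇒' ◇ (⋀ (mapV N xs)))
  mp        : ∀ {A B} → S5CGM n (A ⇒' B) → S5CGM n A → S5CGM n B
  nec       : ∀ {A} → S5CGM n A → S5CGM n (□ A)

{-# OPTIONS --safe #-}
-- Soundness: values of sentences only grow from a fixed point to a larger one, and the
-- minimal fixed point lies below all others, so a variable that is possibly neither is
-- neither there; this gives Ground and Min.
--
-- Completeness: a non-theorem φ is refuted at a world Γ of a finite canonical model, and
-- the worlds agreeing with Γ on boxed formulas form a cluster.  Ground and Min provide a
-- bottom world of the cluster in which each variable is neither or has its value in every
-- other world.  Kripke truth-tellers τ j, whose values can be prescribed independently,
-- together with the liar, which is always neither, then yield sentences σ k whose value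
-- vectors over all fixed points are exactly those of the worlds of the cluster; realizing
-- the variables of φ by them transfers the refutation to FIX.
module Submission where

open import Defs
open import Axiom.DoubleNegationElimination using (em⇒dne)
open import Axiom.ExcludedMiddle using (ExcludedMiddle)
open import Data.Bool using (Bool; true; false)
open import Data.Bool.Properties using (¬-not)
import Data.Bool.Properties as Bool
open import Data.Empty using (⊥; ⊥-elim)
open import Data.Fin using (Fin; toℕ; #_) renaming (zero to fzero; suc to fsuc)
open import Data.Fin.Properties using (toℕ-injective)
open import Data.List using (List; []; _∷_; _++_; map; length; filter)
import Data.List as List
open import Data.List.Membership.Propositional using (_∈_)
open import Data.List.Membership.Propositional.Properties
  using (∈-map⁺; ∈-map⁻; ∈-++⁺ˡ; ∈-++⁺ʳ; ∈-filter⁺; ∈-filter⁻; ∈-lookup)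
open import Data.List.Relation.Binary.Subset.Propositional using (_⊆_)
open import Data.List.Relation.Unary.Any using (here; there)
import Data.List.Relation.Unary.Any as Any
open import Data.List.Relation.Unary.Any.Properties using (lookup-index)
open import Data.Maybe using (Maybe; just; nothing; maybe′)
import Data.Maybe as Maybe
open import Data.Nat using (ℕ; zero; suc; _+_; _*_; _≤_; _<_; z≤n; s≤s; _%_; _/_; _!; _≟_)
open import Data.Nat.Coprimality using (Coprime; coprime-Bézout; coprime-divisor; 1-coprimeTo)
open import Data.Nat.DivMod using (m≡m%n+[m/n]*n; m%n<n; [m+kn]%n≡m%n; m<n⇒m%n≡m; %-remove-+ʳ)
open import Data.Nat.Divisibility
  using (_∣_; ∣-trans; ∣1⇒≡1; ∣m+n∣m⇒∣n; ∣n⇒∣m*n; ∣m⇒∣m*n; n∣m*n; m∣m*n; m≤n⇒m!∣n!)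
open import Data.Nat.GCD using (module Bézout)
open import Data.Nat.Properties
open import Data.Nat.Tactic.RingSolver using (solve-∀)
open import Data.Product using (Σ-syntax; ∃-syntax; _×_; _,_; proj₁; proj₂)
open import Data.Product.Function.NonDependent.Propositional using (_×-⇔_)
open import Data.Sum using (_⊎_; inj₁; inj₂)
import Data.Sum as Sum
open import Data.Vec using (Vec; []; _∷_; lookup; replicate; tabulate)
open import Data.Vec.Properties using (lookup∘tabulate)
open import Function.Base using (_∘_)
open import Function.Bundles using (_⇔_; mk⇔; module Equivalence)
open import Function.Construct.Composition using (_⇔-∘_)
open import Function.Construct.Symmetry using (⇔-sym)
open import Function.Related.TypeIsomorphisms using (¬-cong-⇔)
open import Level using (0ℓ)
open import Relation.Binary using (tri<; tri≈; tri>)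
open import Relation.Binary.PropositionalEquality
open import Relation.Nullary using (¬_; Dec; yes; no; does; contradiction)
open import Relation.Nullary.Decidable using (dec-true; ¬?; _×-dec_; decidable-stable)

open Equivalence using (to; from)

-- Injectivity of the Gödel numbering

tri-mono-≤ : ∀ {m n} → m ≤ n → tri m ≤ tri n
tri-mono-≤ {zero}  _         = z≤n
tri-mono-≤ {suc m} (s≤s m≤n) = +-mono-≤ (s≤s m≤n) (tri-mono-≤ m≤n)

pair-mono-< : ∀ a b c d → a + b < c + d → pair a b < pair c d
pair-mono-< a b c d a+b<c+d = begin-strict
  tri (a + b) + b            <⟨ +-monoʳ-< (tri (a + b)) (s≤s (m≤n+m b a)) ⟩
  tri (a + b) + suc (a + b)  ≡⟨ +-comm (tri (a + b)) (suc (a + b)) ⟩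
  tri (suc (a + b))          ≤⟨ tri-mono-≤ a+b<c+d ⟩
  tri (c + d)                ≤⟨ m≤m+n (tri (c + d)) d ⟩
  pair c d                   ∎
  where open ≤-Reasoning

pair-injective : ∀ {a b c d} → pair a b ≡ pair c d → a ≡ c × b ≡ d
pair-injective {a} {b} {c} {d} eq with <-cmp (a + b) (c + d)
... | tri< lt _ _ = contradiction eq (<⇒≢ (pair-mono-< a b c d lt))
... | tri> _ _ gt = contradiction (sym eq) (<⇒≢ (pair-mono-< c d a b gt))
... | tri≈ _ a+b≡c+d _ = a≡c , b≡d
  where
  b≡d : b ≡ d
  b≡d = +-cancelˡ-≡ (tri (a + b)) b d (trans eq (cong (λ s → tri s + d) (sym a+b≡c+d)))
  a≡c : a ≡ c
  a≡c = +-cancelʳ-≡ b a c (trans a+b≡c+d (cong (c +_) (sym b≡d)))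

termTag termArgs : ∀ {k} → Term k → ℕ
termTag (var i)  = 0
termTag `zero    = 1
termTag (`suc t) = 2
termTag (t `+ u) = 3
termTag (t `* u) = 4
termArgs (var i)  = toℕ i
termArgs `zero    = 0
termArgs (`suc t) = codeT t
termArgs (t `+ u) = pair (codeT t) (codeT u)
termArgs (t `* u) = pair (codeT t) (codeT u)

codeT-tagged : ∀ {k} (t : Term k) → codeT t ≡ pair (termTag t) (termArgs t)
codeT-tagged (var i)  = refl
codeT-tagged `zero    = refl
codeT-tagged (`suc t) = refl
codeT-tagged (t `+ u) = refl
codeT-tagged (t `* u) = refl

codeT-injective : ∀ {k} (t u : Term k) → codeT t ≡ codeT u → t ≡ u
codeT-injective t u eq =
  same-tag-args t u (pair-injective (trans (sym (codeT-tagged t)) (trans eq (codeT-tagged u))))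
  where
  same-tag-args : ∀ {k} (t u : Term k) → termTag t ≡ termTag u × termArgs t ≡ termArgs u → t ≡ u
  same-tag-args (var i) (var j) (_ , e) = cong var (toℕ-injective e)
  same-tag-args `zero `zero _ = refl
  same-tag-args (`suc t) (`suc u) (_ , e) = cong `suc (codeT-injective t u e)
  same-tag-args (t `+ t′) (u `+ u′) (_ , e)
    with e₁ , e₂ ← pair-injective {codeT t} {codeT t′} e =
      cong₂ _`+_ (codeT-injective t u e₁) (codeT-injective t′ u′ e₂)
  same-tag-args (t `* t′) (u `* u′) (_ , e)
    with e₁ , e₂ ← pair-injective {codeT t} {codeT t′} e =
      cong₂ _`*_ (codeT-injective t u e₁) (codeT-injective t′ u′ e₂)
  same-tag-args (var _) `zero (() , _)
  same-tag-args (var _) (`suc _) (() , _)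
  same-tag-args (var _) (_ `+ _) (() , _)
  same-tag-args (var _) (_ `* _) (() , _)
  same-tag-args `zero (var _) (() , _)
  same-tag-args `zero (`suc _) (() , _)
  same-tag-args `zero (_ `+ _) (() , _)
  same-tag-args `zero (_ `* _) (() , _)
  same-tag-args (`suc _) (var _) (() , _)
  same-tag-args (`suc _) `zero (() , _)
  same-tag-args (`suc _) (_ `+ _) (() , _)
  same-tag-args (`suc _) (_ `* _) (() , _)
  same-tag-args (_ `+ _) (var _) (() , _)
  same-tag-args (_ `+ _) `zero (() , _)
  same-tag-args (_ `+ _) (`suc _) (() , _)
  same-tag-args (_ `+ _) (_ `* _) (() , _)
  same-tag-args (_ `* _) (var _) (() , _)
  same-tag-args (_ `* _) `zero (() , _)
  same-tag-args (_ `* _) (`suc _) (() , _)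
  same-tag-args (_ `* _) (_ `+ _) (() , _)

fmTag fmArgs : ∀ {k} → Fm k → ℕ
fmTag (t `≡ u)  = 0
fmTag (`True t) = 1
fmTag (`¬ φ)    = 2
fmTag (φ `∧ ψ)  = 3
fmTag (`∀ φ)    = 4
fmArgs (t `≡ u)  = pair (codeT t) (codeT u)
fmArgs (`True t) = codeT t
fmArgs (`¬ φ)    = code φ
fmArgs (φ `∧ ψ)  = pair (code φ) (code ψ)
fmArgs (`∀ φ)    = code φ

code-tagged : ∀ {k} (φ : Fm k) → code φ ≡ pair (fmTag φ) (fmArgs φ)
code-tagged (t `≡ u)  = refl
code-tagged (`True t) = refl
code-tagged (`¬ φ)    = refl
code-tagged (φ `∧ ψ)  = refl
code-tagged (`∀ φ)    = refl

code-injective : ∀ {k} (φ ψ : Fm k) → code φ ≡ code ψ → φ ≡ ψ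
code-injective φ ψ eq =
  same-tag-args φ ψ (pair-injective (trans (sym (code-tagged φ)) (trans eq (code-tagged ψ))))
  where
  same-tag-args : ∀ {k} (φ ψ : Fm k) → fmTag φ ≡ fmTag ψ × fmArgs φ ≡ fmArgs ψ → φ ≡ ψ
  same-tag-args (t `≡ t′) (u `≡ u′) (_ , e)
    with e₁ , e₂ ← pair-injective {codeT t} {codeT t′} e =
      cong₂ _`≡_ (codeT-injective t u e₁) (codeT-injective t′ u′ e₂)
  same-tag-args (`True t) (`True u) (_ , e) = cong `True (codeT-injective t u e)
  same-tag-args (`¬ φ) (`¬ ψ) (_ , e) = cong `¬ (code-injective φ ψ e)
  same-tag-args (φ `∧ φ′) (ψ `∧ ψ′) (_ , e)
    with e₁ , e₂ ← pair-injective {code φ} {code φ′} e =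
      cong₂ _`∧_ (code-injective φ ψ e₁) (code-injective φ′ ψ′ e₂)
  same-tag-args (`∀ φ) (`∀ ψ) (_ , e) = cong `∀ (code-injective φ ψ e)
  same-tag-args (_ `≡ _) (`True _) (() , _)
  same-tag-args (_ `≡ _) (`¬ _) (() , _)
  same-tag-args (_ `≡ _) (_ `∧ _) (() , _)
  same-tag-args (_ `≡ _) (`∀ _) (() , _)
  same-tag-args (`True _) (_ `≡ _) (() , _)
  same-tag-args (`True _) (`¬ _) (() , _)
  same-tag-args (`True _) (_ `∧ _) (() , _)
  same-tag-args (`True _) (`∀ _) (() , _)
  same-tag-args (`¬ _) (_ `≡ _) (() , _)
  same-tag-args (`¬ _) (`True _) (() , _)
  same-tag-args (`¬ _) (_ `∧ _) (() , _)
  same-tag-args (`¬ _) (`∀ _) (() , _)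
  same-tag-args (_ `∧ _) (_ `≡ _) (() , _)
  same-tag-args (_ `∧ _) (`True _) (() , _)
  same-tag-args (_ `∧ _) (`¬ _) (() , _)
  same-tag-args (_ `∧ _) (`∀ _) (() , _)
  same-tag-args (`∀ _) (_ `≡ _) (() , _)
  same-tag-args (`∀ _) (`True _) (() , _)
  same-tag-args (`∀ _) (`¬ _) (() , _)
  same-tag-args (`∀ _) (_ `∧ _) (() , _)

-- Monotonicity and consistency of strong Kleene evaluation

_⊆ᵇ_ : (ℕ → Bool) → (ℕ → Bool) → Set
S ⊆ᵇ S′ = ∀ n → S n ≡ true → S′ n ≡ true

Tr-mono : ∀ {S S′} → S ⊆ᵇ S′ → ∀ {k} {φ : Fm k} {ρ} → Tr S φ ρ → Tr S′ φ ρ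
Fl-mono : ∀ {S S′} → S ⊆ᵇ S′ → ∀ {k} {φ : Fm k} {ρ} → Fl S φ ρ → Fl S′ φ ρ
Tr-mono S⊆S′ (tr-≡ e)      = tr-≡ e
Tr-mono S⊆S′ (tr-True s)   = tr-True (S⊆S′ _ s)
Tr-mono S⊆S′ (tr-¬ f)      = tr-¬ (Fl-mono S⊆S′ f)
Tr-mono S⊆S′ (tr-∧ t u)    = tr-∧ (Tr-mono S⊆S′ t) (Tr-mono S⊆S′ u)
Tr-mono S⊆S′ (tr-∀ t)      = tr-∀ (λ m → Tr-mono S⊆S′ (t m))
Fl-mono S⊆S′ (fl-≡ e)      = fl-≡ e
Fl-mono S⊆S′ (fl-nonSent e) = fl-nonSent e
Fl-mono S⊆S′ (fl-negIn φ e s) = fl-negIn φ e (S⊆S′ _ s)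
Fl-mono S⊆S′ (fl-¬ t)      = fl-¬ (Tr-mono S⊆S′ t)
Fl-mono S⊆S′ (fl-∧ˡ f)     = fl-∧ˡ (Fl-mono S⊆S′ f)
Fl-mono S⊆S′ (fl-∧ʳ f)     = fl-∧ʳ (Fl-mono S⊆S′ f)
Fl-mono S⊆S′ (fl-∀ m f)    = fl-∀ m (Fl-mono S⊆S′ f)

Tr-¬⁻¹ : ∀ {S k} {φ : Fm k} {ρ} → Tr S (`¬ φ) ρ → Fl S φ ρ
Tr-¬⁻¹ (tr-¬ f) = f

Fl-¬⁻¹ : ∀ {S k} {φ : Fm k} {ρ} → Fl S (`¬ φ) ρ → Tr S φ ρ
Fl-¬⁻¹ (fl-¬ t) = t

SentenceCodes : (ℕ → Bool) → Set
SentenceCodes S = ∀ n → S n ≡ true → Σ[ φ ∈ Sentence ] code φ ≡ n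

record Compatible (S S′ : ℕ → Bool) : Set where
  field
    codesˡ : SentenceCodes S
    codesʳ : SentenceCodes S′
    ¬-in-right : ∀ (ψ : Sentence) → S (code ψ) ≡ true → S′ (code (`¬ ψ)) ≡ true → ⊥
    ¬-in-left  : ∀ (ψ : Sentence) → S (code (`¬ ψ)) ≡ true → S′ (code ψ) ≡ true → ⊥

Tr⇒¬Fl : ∀ {S S′} → Compatible S S′ → ∀ {k} {φ : Fm k} {ρ} → Tr S φ ρ → ¬ Fl S′ φ ρ
Fl⇒¬Tr : ∀ {S S′} → Compatible S S′ → ∀ {k} {φ : Fm k} {ρ} → Fl S φ ρ → ¬ Tr S′ φ ρ
Tr⇒¬Fl c (tr-≡ e) (fl-≡ e′) = e′ e
Tr⇒¬Fl c (tr-True s) (fl-nonSent e) = e (Compatible.codesˡ c _ s)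
Tr⇒¬Fl {S} c (tr-True s) (fl-negIn ψ e s′) =
  Compatible.¬-in-right c ψ (subst (λ n → S n ≡ true) (sym e) s) s′
Tr⇒¬Fl c (tr-¬ f) (fl-¬ t) = Fl⇒¬Tr c f t
Tr⇒¬Fl c (tr-∧ t _) (fl-∧ˡ f) = Tr⇒¬Fl c t f
Tr⇒¬Fl c (tr-∧ _ t) (fl-∧ʳ f) = Tr⇒¬Fl c t f
Tr⇒¬Fl c (tr-∀ t) (fl-∀ m f) = Tr⇒¬Fl c (t m) f
Fl⇒¬Tr c (fl-≡ e′) (tr-≡ e) = e′ e
Fl⇒¬Tr c (fl-nonSent e) (tr-True s) = e (Compatible.codesʳ c _ s)
Fl⇒¬Tr {S′ = S′} c (fl-negIn ψ e s′) (tr-True s) =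
  Compatible.¬-in-left c ψ s′ (subst (λ n → S′ n ≡ true) (sym e) s)
Fl⇒¬Tr c (fl-¬ t) (tr-¬ f) = Tr⇒¬Fl c t f
Fl⇒¬Tr c (fl-∧ˡ f) (tr-∧ t _) = Fl⇒¬Tr c f t
Fl⇒¬Tr c (fl-∧ʳ f) (tr-∧ _ t) = Fl⇒¬Tr c f t
Fl⇒¬Tr c (fl-∀ m f) (tr-∀ t) = Fl⇒¬Tr c f (t m)

-- Fixed points

Jump : (ℕ → Bool) → ℕ → Set
Jump S n = Σ[ φ ∈ Sentence ] code φ ≡ n × TrueIn S φ

Jump-mono : ∀ {S S′} → S ⊆ᵇ S′ → ∀ n → Jump S n → Jump S′ n
Jump-mono S⊆S′ n (φ , e , t) = φ , e , Tr-mono S⊆S′ t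

Jump-code : ∀ {S} (φ : Sentence) → Jump S (code φ) → TrueIn S φ
Jump-code {S} φ (ψ , e , t) = subst (TrueIn S) (code-injective ψ φ e) t

fixed-∈⇒Tr : (w : FIX) (φ : Sentence) → proj₁ w (code φ) ≡ true → TrueIn (proj₁ w) φ
fixed-∈⇒Tr (S , fixed , _) φ s = Jump-code φ (proj₁ (fixed (code φ)) s)

fixed-compatible : (w : FIX) → Compatible (proj₁ w) (proj₁ w)
fixed-compatible (S , fixed , consistent) = record
  { codesˡ = codes ; codesʳ = codes
  ; ¬-in-right = consistent
  ; ¬-in-left = λ ψ s¬ψ sψ → consistent ψ sψ s¬ψ }
  where
  codes : SentenceCodes S
  codes n s = let (φ , e , _) = proj₁ (fixed n) s in φ , e

fixed-Tr⇒¬Fl : (w : FIX) → ∀ {k} {φ : Fm k} {ρ} → Tr (proj₁ w) φ ρ → ¬ Fl (proj₁ w) φ ρ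
fixed-Tr⇒¬Fl w = Tr⇒¬Fl (fixed-compatible w)

dec-true⁻¹ : ∀ {P : Set} (d : Dec P) → does d ≡ true → P
dec-true⁻¹ (yes p) _ = p

-- The least set containing S₀ and closed under the jump, defined impredicatively
-- as the intersection of all such sets; excluded middle makes it a Boolean set.
module LeastClosed (lem : ExcludedMiddle 0ℓ) (S₀ : ℕ → Bool) where

  Closed : (ℕ → Bool) → Set
  Closed X = ∀ n → Jump X n ⊎ S₀ n ≡ true → X n ≡ true

  L : ℕ → Bool
  L n = does (lem {∀ X → Closed X → X n ≡ true})

  L-least : ∀ X → Closed X → L ⊆ᵇ X
  L-least X closed n l = dec-true⁻¹ lem l X closed

  L-closed : Closed L
  L-closed n h = dec-true lem (λ X closed → closed n (Jump∪S₀⊆ X closed h))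
    where
    Jump∪S₀⊆ : ∀ X → Closed X → Jump L n ⊎ S₀ n ≡ true → Jump X n ⊎ S₀ n ≡ true
    Jump∪S₀⊆ X closed (inj₁ j) = inj₁ (Jump-mono (L-least X closed) n j)
    Jump∪S₀⊆ X closed (inj₂ s) = inj₂ s

  S₀⊆L : S₀ ⊆ᵇ L
  S₀⊆L n s = L-closed n (inj₂ s)

  L-supported : ∀ n → L n ≡ true → Jump L n ⊎ S₀ n ≡ true
  L-supported n l = dec-true⁻¹ lem (L-least Y Y-closed n l)
    where
    Y : ℕ → Bool
    Y m = does (lem {Jump L m ⊎ S₀ m ≡ true})
    Y⊆L : Y ⊆ᵇ L
    Y⊆L m y = L-closed m (dec-true⁻¹ lem y)
    Y-closed : Closed Y
    Y-closed m (inj₁ j) = dec-true lem (inj₁ (Jump-mono Y⊆L m j))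
    Y-closed m (inj₂ s) = dec-true lem (inj₂ s)

  module FixedPoint (S₀-sound : ∀ n → S₀ n ≡ true → Jump S₀ n) where

    L⇒Jump : ∀ n → L n ≡ true → Jump L n
    L⇒Jump n l with L-supported n l
    ... | inj₁ j = j
    ... | inj₂ s = Jump-mono S₀⊆L n (S₀-sound n s)

    L-codes : SentenceCodes L
    L-codes n l = let (φ , e , _) = L⇒Jump n l in φ , e

    L⇒Tr : ∀ (φ : Sentence) → L (code φ) ≡ true → TrueIn L φ
    L⇒Tr φ l = Jump-code φ (L⇒Jump (code φ) l)

    module Consistent
      (S₀-¬L : ∀ (ψ : Sentence) → S₀ (code ψ) ≡ true → L (code (`¬ ψ)) ≡ true → ⊥)
      (¬S₀-L : ∀ (ψ : Sentence) → S₀ (code (`¬ ψ)) ≡ true → L (code ψ) ≡ true → ⊥) where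

      -- Consistency by induction along L: its conflict-free part P is closed, hence all of L.
      NoConflict : ℕ → Set
      NoConflict n = L n ≡ true
                   × (∀ (ψ : Sentence) → code ψ ≡ n → L (code (`¬ ψ)) ≡ true → ⊥)
                   × (∀ (ψ : Sentence) → code (`¬ ψ) ≡ n → L (code ψ) ≡ true → ⊥)

      P : ℕ → Bool
      P n = does (lem {NoConflict n})

      P⊆L : P ⊆ᵇ L
      P⊆L n p = proj₁ (dec-true⁻¹ lem p)

      P-L-compatible : Compatible P L
      P-L-compatible = record
        { codesˡ = λ n p → L-codes n (P⊆L n p) ; codesʳ = L-codes
        ; ¬-in-right = λ ψ p → proj₁ (proj₂ (dec-true⁻¹ lem p)) ψ refl
        ; ¬-in-left = λ ψ p → proj₂ (proj₂ (dec-true⁻¹ lem p)) ψ refl }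

      P-closed : Closed P
      P-closed n (inj₂ s) = dec-true lem (S₀⊆L n s , S₀-¬L′ , ¬S₀-L′)
        where
        S₀-¬L′ : ∀ (ψ : Sentence) → code ψ ≡ n → L (code (`¬ ψ)) ≡ true → ⊥
        S₀-¬L′ ψ refl = S₀-¬L ψ s
        ¬S₀-L′ : ∀ (ψ : Sentence) → code (`¬ ψ) ≡ n → L (code ψ) ≡ true → ⊥
        ¬S₀-L′ ψ refl = ¬S₀-L ψ s
      P-closed n (inj₁ (φ , refl , t)) =
        dec-true lem (L-closed n (inj₁ (Jump-mono P⊆L n (φ , refl , t))) , ¬φ∉L , φ∉L)
        where
        ¬φ∉L : ∀ (ψ : Sentence) → code ψ ≡ code φ → L (code (`¬ ψ)) ≡ true → ⊥
        ¬φ∉L ψ e l with refl ← code-injective φ ψ (sym e) =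
          Tr⇒¬Fl P-L-compatible t (Tr-¬⁻¹ (L⇒Tr (`¬ ψ) l))
        φ∉L : ∀ (ψ : Sentence) → code (`¬ ψ) ≡ code φ → L (code ψ) ≡ true → ⊥
        φ∉L ψ e l with refl ← code-injective φ (`¬ ψ) (sym e) =
          Fl⇒¬Tr P-L-compatible (Tr-¬⁻¹ t) (L⇒Tr ψ l)

      fixed-point : FIX
      fixed-point = L , (λ n → L⇒Jump n , L-closed n ∘ inj₁) , L-consistent
        where
        L-consistent : (φ : Sentence) → L (code φ) ≡ true → L (code (`¬ φ)) ≡ true → ⊥
        L-consistent φ l = proj₁ (proj₂ (dec-true⁻¹ lem (L-least P P-closed _ l))) φ refl

infix 4 _⊨_

_⊨_ : (MF → Bool) → MF → Set
v ⊨ T x    = v (T x) ≡ true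
v ⊨ F x    = v (F x) ≡ true
v ⊨ ¬' A   = ¬ (v ⊨ A)
v ⊨ A ∧' B = v ⊨ A × v ⊨ B
v ⊨ □ A    = v (□ A) ≡ true

⊨-dec : ∀ v A → Dec (v ⊨ A)
⊨-dec v (T x)    = v (T x) Bool.≟ true
⊨-dec v (F x)    = v (F x) Bool.≟ true
⊨-dec v (¬' A)   = ¬? (⊨-dec v A)
⊨-dec v (A ∧' B) = ⊨-dec v A ×-dec ⊨-dec v B
⊨-dec v (□ A)    = v (□ A) Bool.≟ true

⊨-stable : ∀ v A → ¬ ¬ v ⊨ A → v ⊨ A
⊨-stable v A = decidable-stable (⊨-dec v A)

⊨-⇒ : ∀ v A B → v ⊨ (A ⇒' B) ⇔ (v ⊨ A → v ⊨ B)
⊨-⇒ v A B = mk⇔ (λ h a → ⊨-stable v B (λ ¬b → h (a , ¬b))) (λ f (a , ¬b) → ¬b (f a))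

false≢true : false ≢ true
false≢true ()

evalB⇔⊨ : ∀ v A → evalB v A ≡ true ⇔ v ⊨ A
evalB⇔⊨ v (T x) = mk⇔ (λ e → e) (λ e → e)
evalB⇔⊨ v (F x) = mk⇔ (λ e → e) (λ e → e)
evalB⇔⊨ v (□ A) = mk⇔ (λ e → e) (λ e → e)
evalB⇔⊨ v (¬' A) with evalB v A | evalB⇔⊨ v A
... | true  | A⇔ = mk⇔ (λ ()) (λ ¬a → contradiction (to A⇔ refl) ¬a)
... | false | A⇔ = mk⇔ (λ _ a → false≢true (from A⇔ a)) (λ _ → refl)
evalB⇔⊨ v (A ∧' B) with evalB v A | evalB⇔⊨ v A
... | true  | A⇔ = mk⇔ (λ b → to A⇔ refl , to (evalB⇔⊨ v B) b) (λ (_ , b) → from (evalB⇔⊨ v B) b)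
... | false | A⇔ = mk⇔ (λ ()) (λ (a , _) → ⊥-elim (false≢true (from A⇔ a)))

⊨-⊤' : ∀ v → v ⊨ ⊤'
⊨-⊤' v (t , ¬t) = ¬t t

-- Soundness

minimal-fixed-point : ExcludedMiddle 0ℓ → FIX
minimal-fixed-point lem =
  LeastClosed.FixedPoint.Consistent.fixed-point lem (λ _ → false) (λ _ ()) (λ _ ()) (λ _ ())

minimal-least : (lem : ExcludedMiddle 0ℓ) (w : FIX) → proj₁ (minimal-fixed-point lem) ⊆ᵇ proj₁ w
minimal-least lem (S , fixed , _) = LeastClosed.L-least lem (λ _ → false) S S-closed
  where
  S-closed : LeastClosed.Closed lem (λ _ → false) S
  S-closed n (inj₁ j) = proj₂ (fixed n) j

⊩-⋀⁺ : ∀ ⋆ w (f : ℕ → MF) {n} (xs : Vec ℕ n) →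
       (∀ i → ⋆ , w ⊩ f (lookup xs i)) → ⋆ , w ⊩ ⋀ (mapV f xs)
⊩-⋀⁺ ⋆ w f []           h (t , ¬t) = ¬t t
⊩-⋀⁺ ⋆ w f (x ∷ [])     h = h fzero
⊩-⋀⁺ ⋆ w f (x ∷ y ∷ xs) h = h fzero , ⊩-⋀⁺ ⋆ w f (y ∷ xs) (h ∘ fsuc)

⊩-⋀⁻ : ∀ ⋆ w (f : ℕ → MF) {n} (xs : Vec ℕ n) →
       ⋆ , w ⊩ ⋀ (mapV f xs) → ∀ i → ⋆ , w ⊩ f (lookup xs i)
⊩-⋀⁻ ⋆ w f (x ∷ [])     h fzero    = h
⊩-⋀⁻ ⋆ w f (x ∷ y ∷ xs) h fzero    = proj₁ h
⊩-⋀⁻ ⋆ w f (x ∷ y ∷ xs) h (fsuc i) = ⊩-⋀⁻ ⋆ w f (y ∷ xs) (proj₂ h) i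

module Soundness (lem : ExcludedMiddle 0ℓ) where

  ⊩-⇒' : ∀ ⋆ w A B → ⋆ , w ⊩ (A ⇒' B) ⇔ (⋆ , w ⊩ A → ⋆ , w ⊩ B)
  ⊩-⇒' ⋆ w A B = mk⇔ (λ h a → em⇒dne lem (λ ¬b → h (a , ¬b))) (λ f (a , ¬b) → ¬b (f a))

  tautology-sound : ∀ {A} → Tautology A → FIX⊩ A
  tautology-sound {A} taut ⋆ w = to (⊨⇔⊩ A) (to (evalB⇔⊨ v A) (taut v))
    where
    v : MF → Bool
    v B = does (lem {⋆ , w ⊩ B})
    ⊨⇔⊩ : ∀ A → v ⊨ A ⇔ (⋆ , w ⊩ A)
    ⊨⇔⊩ (T x)    = mk⇔ (dec-true⁻¹ lem) (dec-true lem)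
    ⊨⇔⊩ (F x)    = mk⇔ (dec-true⁻¹ lem) (dec-true lem)
    ⊨⇔⊩ (□ A)    = mk⇔ (dec-true⁻¹ lem) (dec-true lem)
    ⊨⇔⊩ (¬' A)   = ¬-cong-⇔ (⊨⇔⊩ A)
    ⊨⇔⊩ (A ∧' B) = ⊨⇔⊩ A ×-⇔ ⊨⇔⊩ B

  private
    m : FIX
    m = minimal-fixed-point lem

  -- Values in the minimal fixed point persist to every fixed point.
  ◇N⇒minimal-N : ∀ ⋆ x w → ⋆ , w ⊩ ◇ (N x) → ⋆ , m ⊩ N x
  ◇N⇒minimal-N ⋆ x w ◇N =
      (λ t → ◇N (λ v (¬t , _) → ¬t (Tr-mono (minimal-least lem v) t)))
    , (λ f → ◇N (λ v (_ , ¬f) → ¬f (Fl-mono (minimal-least lem v) f)))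

  ground-sound : ∀ ⋆ x w → ⋆ , w ⊩ ((◇ (T x) ∧' ◇ (F x)) ⇒' ◇ (N x))
  ground-sound ⋆ x w ((◇T , ◇F) , ¬◇N) with lem {TrueIn (proj₁ m) (⋆ x)} | lem {FalseIn (proj₁ m) (⋆ x)}
  ... | yes t | _    = ◇F (λ v f → fixed-Tr⇒¬Fl v (Tr-mono (minimal-least lem v) t) f)
  ... | no _  | yes f = ◇T (λ v t → fixed-Tr⇒¬Fl v t (Fl-mono (minimal-least lem v) f))
  ... | no ¬t | no ¬f = ¬◇N (λ □¬N → □¬N m (¬t , ¬f))

  min-sound : ∀ ⋆ w {n} (xs : Vec ℕ n) → ⋆ , w ⊩ (⋀ (mapV (λ x → ◇ (N x)) xs) ⇒' ◇ (⋀ (mapV N xs)))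
  min-sound ⋆ w xs (all◇N , ¬◇⋀N) = ¬◇⋀N (λ □¬⋀N → □¬⋀N m
    (⊩-⋀⁺ ⋆ m N xs (λ i → ◇N⇒minimal-N ⋆ (lookup xs i) w (⊩-⋀⁻ ⋆ w (λ x → ◇ (N x)) xs all◇N i))))

  soundness : ∀ {n A} → S5CGM n A → FIX⊩ A
  soundness (ax-taut t) = tautology-sound t
  soundness (ax-K A B) ⋆ w = from (⊩-⇒' ⋆ w (□ (A ⇒' B)) (□ A ⇒' □ B)) (λ □A⇒B →
    from (⊩-⇒' ⋆ w (□ A) (□ B)) (λ □A v → to (⊩-⇒' ⋆ v A B) (□A⇒B v) (□A v)))
  soundness (ax-T A) ⋆ w = from (⊩-⇒' ⋆ w (□ A) A) (λ □A → □A w)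
  soundness (ax-5 A) ⋆ w = from (⊩-⇒' ⋆ w (◇ A) (□ (◇ A))) (λ ◇A _ → ◇A)
  soundness (ax-Con x) ⋆ w (t , f) = fixed-Tr⇒¬Fl w t f
  soundness (ax-Ground x) ⋆ w = ground-sound ⋆ x w
  soundness (ax-Min xs) ⋆ w = min-sound ⋆ w xs
  soundness (mp {A} {B} ⊢A⇒B ⊢A) ⋆ w = to (⊩-⇒' ⋆ w A B) (soundness ⊢A⇒B ⋆ w) (soundness ⊢A ⋆ w)
  soundness (nec ⊢A) ⋆ w v = soundness ⊢A ⋆ v

-- The Chinese remainder theorem and Gödel's β-function

Rem : ℕ → ℕ → ℕ → Set
Rem a d r = r < d × ∃[ q ] a ≡ q * d + r

Rem⇒% : ∀ {a d r} → Rem a (suc d) r → a % suc d ≡ r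
Rem⇒% {a} {d} {r} (r<d , q , refl) = begin
  (q * suc d + r) % suc d  ≡⟨ cong (_% suc d) (+-comm (q * suc d) r) ⟩
  (r + q * suc d) % suc d  ≡⟨ [m+kn]%n≡m%n r q (suc d) ⟩
  r % suc d                ≡⟨ m<n⇒m%n≡m r<d ⟩
  r                        ∎
  where open ≡-Reasoning

%⇒Rem : ∀ a d → Rem a (suc d) (a % suc d)
%⇒Rem a d = m%n<n a (suc d) , a / suc d , trans (m≡m%n+[m/n]*n a (suc d)) (+-comm (a % suc d) _)

Rem-functional : ∀ {a d r r′} → Rem a (suc d) r → Rem a (suc d) r′ → r ≡ r′
Rem-functional rem rem′ = trans (sym (Rem⇒% rem)) (Rem⇒% rem′)

coprime-*ˡ : ∀ {m n o} → Coprime m o → Coprime n o → Coprime (m * n) o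
coprime-*ˡ {m} {n} {o} m⊥o n⊥o {f} (f∣mn , f∣o) = n⊥o (coprime-divisor f⊥m f∣mn , f∣o)
  where
  f⊥m : Coprime f m
  f⊥m (g∣f , g∣m) = m⊥o (g∣m , ∣-trans g∣f f∣o)

bézout-residue : ∀ a₀ M n r → Coprime M (suc n) → r < suc n → ∃[ t ] (a₀ + M * t) % suc n ≡ r
bézout-residue a₀ M n r M⊥n r<n with coprime-Bézout M⊥n
... | Bézout.+- u y 1+yn≡uM = u * c , (begin
  (a₀ + M * (u * c)) % suc n          ≡⟨ cong (λ z → (a₀ + z) % suc n) (*-assoc-swap M u c) ⟩
  (a₀ + u * M * c) % suc n            ≡⟨ cong (λ z → (a₀ + z * c) % suc n) (sym 1+yn≡uM) ⟩
  (a₀ + (1 + y * suc n) * c) % suc n  ≡⟨ cong (_% suc n) (regroup a₀ y n r) ⟩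
  (r + (a₀ + y * c) * suc n) % suc n  ≡⟨ [m+kn]%n≡m%n r (a₀ + y * c) (suc n) ⟩
  r % suc n                           ≡⟨ m<n⇒m%n≡m r<n ⟩
  r                                   ∎)
  where
  open ≡-Reasoning
  c : ℕ
  c = r + n * a₀
  *-assoc-swap : ∀ M u c → M * (u * c) ≡ u * M * c
  *-assoc-swap = solve-∀
  regroup : ∀ a₀ y n r → a₀ + (1 + y * (1 + n)) * (r + n * a₀) ≡ r + (a₀ + y * (r + n * a₀)) * (1 + n)
  regroup = solve-∀
... | Bézout.-+ u y 1+uM≡yn = u * c , (begin
  (a₀ + M * (u * c)) % suc n                ≡⟨ sym ([m+kn]%n≡m%n (a₀ + M * (u * c)) r (suc n)) ⟩
  (a₀ + M * (u * c) + r * suc n) % suc n    ≡⟨ cong (_% suc n) (regroup a₀ M u n r) ⟩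
  ((1 + u * M) * c + r) % suc n             ≡⟨ cong (λ z → (z * c + r) % suc n) 1+uM≡yn ⟩
  (y * suc n * c + r) % suc n               ≡⟨ cong (_% suc n) (swap y (suc n) c r) ⟩
  (r + y * c * suc n) % suc n               ≡⟨ [m+kn]%n≡m%n r (y * c) (suc n) ⟩
  r % suc n                                 ≡⟨ m<n⇒m%n≡m r<n ⟩
  r                                         ∎)
  where
  open ≡-Reasoning
  c : ℕ
  c = a₀ + n * r
  regroup : ∀ a₀ M u n r → a₀ + M * (u * (a₀ + n * r)) + r * (1 + n) ≡ (1 + u * M) * (a₀ + n * r) + r
  regroup = solve-∀
  swap : ∀ y m c r → y * m * c + r ≡ r + y * c * m
  swap = solve-∀

module ChineseRemainder (μ : ℕ → ℕ) where

  ∏ : ℕ → ℕ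
  ∏ zero    = 1
  ∏ (suc k) = ∏ k * suc (μ k)

  modulus∣∏ : ∀ {i k} → i < k → suc (μ i) ∣ ∏ k
  modulus∣∏ {i} {suc k} (s≤s i≤k) with m≤n⇒m<n∨m≡n i≤k
  ... | inj₁ i<k = ∣m⇒∣m*n (suc (μ k)) (modulus∣∏ i<k)
  ... | inj₂ refl = n∣m*n (∏ i)

  ∏-coprime : ∀ k j → (∀ i → i < k → Coprime (suc (μ i)) (suc (μ j))) → Coprime (∏ k) (suc (μ j))
  ∏-coprime zero    j _      = 1-coprimeTo (suc (μ j))
  ∏-coprime (suc k) j coprime =
    coprime-*ˡ (∏-coprime k j (λ i i<k → coprime i (m<n⇒m<1+n i<k))) (coprime k ≤-refl)

  crt : (s : ℕ → ℕ) (k : ℕ) →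
        (∀ i j → i < j → j < k → Coprime (suc (μ i)) (suc (μ j))) →
        (∀ i → i < k → s i < suc (μ i)) →
        ∃[ a ] ∀ i → i < k → a % suc (μ i) ≡ s i
  crt s zero    _       _     = 0 , λ _ ()
  crt s (suc k) coprime small
    with a₀ , a₀-ok ← crt s k (λ i j i<j j<k → coprime i j i<j (m<n⇒m<1+n j<k))
                              (λ i i<k → small i (m<n⇒m<1+n i<k))
    with t , t-ok ← bézout-residue a₀ (∏ k) (μ k) (s k) (∏-coprime k k (λ i i<k → coprime i k i<k ≤-refl))
                                   (small k ≤-refl)
    = a₀ + ∏ k * t , a-ok
    where
    a-ok : ∀ i → i < suc k → (a₀ + ∏ k * t) % suc (μ i) ≡ s i
    a-ok i (s≤s i≤k) with m≤n⇒m<n∨m≡n i≤k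
    ... | inj₁ i<k = trans (%-remove-+ʳ a₀ (∣m⇒∣m*n t (modulus∣∏ i<k))) (a₀-ok i i<k)
    ... | inj₂ refl = t-ok

βmodulus : ℕ → ℕ → ℕ
βmodulus b i = suc (suc i * b)

β-coprime : ∀ b i o → suc o ∣ b → Coprime (βmodulus b i) (βmodulus b (suc i + o))
β-coprime b i o o+1∣b {c} (c∣βᵢ , c∣βⱼ) = ∣1⇒≡1 (∣m+n∣m⇒∣n c∣1+ib (∣n⇒∣m*n (suc i) c∣b))
  where
  split : ∀ i o b → 1 + (1 + (1 + i + o)) * b ≡ (1 + (1 + i) * b) + (1 + o) * b
  split = solve-∀
  c∣1+ib : c ∣ suc i * b + 1
  c∣1+ib = subst (c ∣_) (+-comm 1 (suc i * b)) c∣βᵢ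
  c⊥b : Coprime c b
  c⊥b (f∣c , f∣b) = ∣1⇒≡1 (∣m+n∣m⇒∣n (∣-trans f∣c c∣1+ib) (∣n⇒∣m*n (suc i) f∣b))
  c∣b : c ∣ b
  c∣b = ∣-trans (coprime-divisor c⊥b (subst (c ∣_) (*-comm (suc o) b)
          (∣m+n∣m⇒∣n (subst (c ∣_) (split i o b) c∣βⱼ) c∣βᵢ))) o+1∣b

prefixSum : (ℕ → ℕ) → ℕ → ℕ
prefixSum s zero    = s 0
prefixSum s (suc x) = s (suc x) + prefixSum s x

prefixSum-≤ : ∀ s {i x} → i ≤ x → s i ≤ prefixSum s x
prefixSum-≤ s {zero}  {zero}  _ = ≤-refl
prefixSum-≤ s {i}     {suc x} i≤1+x with m≤n⇒m<n∨m≡n i≤1+x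
... | inj₁ (s≤s i≤x) = ≤-trans (prefixSum-≤ s i≤x) (m≤n+m (prefixSum s x) (s (suc x)))
... | inj₂ refl      = m≤m+n (s (suc x)) (prefixSum s x)

-- b = K! with K above x and every s i makes the moduli 1 + (1 + i) b pairwise coprime
-- and larger than the s i.
β-lemma : (s : ℕ → ℕ) (x : ℕ) → ∃[ a ] ∃[ b ] ∀ i → i ≤ x → Rem a (βmodulus b i) (s i)
β-lemma s x = a , b , λ i i≤x → subst (Rem a (βmodulus b i)) (a-ok i (s≤s i≤x)) (%⇒Rem a (suc i * b))
  where
  K b : ℕ
  K = suc (x + prefixSum s x)
  b = K !
  small : ∀ i → i < suc x → s i < βmodulus b i
  small i (s≤s i≤x) = s≤s (begin
    s i               ≤⟨ prefixSum-≤ s i≤x ⟩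
    prefixSum s x     ≤⟨ m≤n+m (prefixSum s x) x ⟩
    x + prefixSum s x ≤⟨ n≤1+n _ ⟩
    K                 ≤⟨ subst (_≤ K !) (*-identityʳ K) (*-monoʳ-≤ K (1≤n! (x + prefixSum s x))) ⟩
    b                 ≤⟨ m≤m+n b (i * b) ⟩
    suc i * b         ∎)
    where open ≤-Reasoning
  coprime : ∀ i j → i < j → j < suc x → Coprime (βmodulus b i) (βmodulus b j)
  coprime i j i<j (s≤s j≤x) with o , refl ← m≤n⇒∃[o]m+o≡n i<j =
    β-coprime b i o (∣-trans (m∣m*n (o !)) (m≤n⇒m!∣n! (≤-trans (s≤s (m≤n+m o i)) (≤-trans j≤x′ (n≤1+n _)))))
    where
    j≤x′ : suc i + o ≤ x + prefixSum s x
    j≤x′ = ≤-trans j≤x (m≤m+n x (prefixSum s x))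
  solution : ∃[ a ] ∀ i → i < suc x → a % βmodulus b i ≡ s i
  solution = ChineseRemainder.crt (λ i → suc i * b) s (suc x) coprime small
  a : ℕ
  a = proj₁ solution
  a-ok : ∀ i → i < suc x → a % βmodulus b i ≡ s i
  a-ok = proj₂ solution

-- Arithmetical definability

weaken : ∀ {k} → Term k → Term (suc k)
weaken (var i)  = var (fsuc i)
weaken `zero    = `zero
weaken (`suc t) = `suc (weaken t)
weaken (t `+ u) = weaken t `+ weaken u
weaken (t `* u) = weaken t `* weaken u

eval-weaken : ∀ {k} (t : Term k) m ρ → evalT (weaken t) (m ∷ ρ) ≡ evalT t ρ
eval-weaken (var i)  m ρ = refl
eval-weaken `zero    m ρ = refl
eval-weaken (`suc t) m ρ = cong suc (eval-weaken t m ρ)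
eval-weaken (t `+ u) m ρ = cong₂ _+_ (eval-weaken t m ρ) (eval-weaken u m ρ)
eval-weaken (t `* u) m ρ = cong₂ _*_ (eval-weaken t m ρ) (eval-weaken u m ρ)

numeral : ∀ {k} → ℕ → Term k
numeral zero    = `zero
numeral (suc n) = `suc (numeral n)

eval-numeral : ∀ {k} n (ρ : Vec ℕ k) → evalT (numeral n) ρ ≡ n
eval-numeral zero    ρ = refl
eval-numeral (suc n) ρ = cong suc (eval-numeral n ρ)

numeralCode : ℕ → ℕ
numeralCode zero    = pair 1 0
numeralCode (suc n) = pair 2 (numeralCode n)

codeT-numeral : ∀ {k} n → codeT (numeral {k} n) ≡ numeralCode n
codeT-numeral zero    = refl
codeT-numeral (suc n) = cong (pair 2) (codeT-numeral n)

`∃ : ∀ {k} → Fm (suc k) → Fm k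
`∃ φ = `¬ (`∀ (`¬ φ))

_`⇒_ : ∀ {k} → Fm k → Fm k → Fm k
φ `⇒ ψ = `¬ (φ `∧ `¬ ψ)

LessF : ∀ {k} → Term k → Term k → Fm k
LessF a b = `∃ ((weaken a `+ `suc (var fzero)) `≡ weaken b)

RemF : ∀ {k} → Term k → Term k → Term k → Fm k
RemF a d r = LessF r d `∧ `∃ (weaken a `≡ ((var fzero `* weaken d) `+ weaken r))

βF : ∀ {k} → Term k → Term k → Term k → Term k → Fm k
βF a b i r = RemF a (`suc (`suc i `* b)) r

-- Cantor pairing without division: 2 z = (p + q)(p + q + 1) + 2 q.
PairF : ∀ {k} → Term k → Term k → Term k → Fm k
PairF p q z = (numeral 2 `* z) `≡ (((p `+ q) `* `suc (p `+ q)) `+ (numeral 2 `* q))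

LetPair : ∀ {k} → Term k → Term k → Fm (suc k) → Fm k
LetPair p q φ = `∃ (PairF (weaken p) (weaken q) (var fzero) `∧ φ)

2*tri : ∀ s → 2 * tri s ≡ s * suc s
2*tri zero    = refl
2*tri (suc s) = begin
  2 * (suc s + tri s)        ≡⟨ *-distribˡ-+ 2 (suc s) (tri s) ⟩
  2 * suc s + 2 * tri s      ≡⟨ cong (2 * suc s +_) (2*tri s) ⟩
  2 * suc s + s * suc s      ≡⟨ step s ⟩
  suc s * suc (suc s)        ∎
  where
  open ≡-Reasoning
  step : ∀ s → 2 * (1 + s) + s * (1 + s) ≡ (1 + s) * (2 + s)
  step = solve-∀

pair-equation : ∀ p q z → (2 * z ≡ (p + q) * suc (p + q) + 2 * q) ⇔ (z ≡ pair p q)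
pair-equation p q z = mk⇔ (λ e → *-cancelˡ-≡ z (pair p q) 2 (trans e (sym 2*pair)))
                          (λ e → trans (cong (2 *_) e) 2*pair)
  where
  2*pair : 2 * pair p q ≡ (p + q) * suc (p + q) + 2 * q
  2*pair = trans (*-distribˡ-+ 2 (tri (p + q)) q) (cong (_+ 2 * q) (2*tri (p + q)))

record Defines {k} (φ : Fm k) (P : Vec ℕ k → Set) : Set where
  field
    Tr⇔ : ∀ S ρ → Tr S φ ρ ⇔ P ρ
    Fl⇔ : ∀ S ρ → Fl S φ ρ ⇔ (¬ P ρ)
open Defines

Defines-cong : ∀ {k} {φ : Fm k} {P Q} → Defines φ P → (∀ ρ → P ρ ⇔ Q ρ) → Defines φ Q
Defines-cong d P⇔Q = record
  { Tr⇔ = λ S ρ → P⇔Q ρ ⇔-∘ Tr⇔ d S ρ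
  ; Fl⇔ = λ S ρ → ¬-cong-⇔ (P⇔Q ρ) ⇔-∘ Fl⇔ d S ρ }

Defines-≡ : ∀ {k} (t u : Term k) → Defines (t `≡ u) (λ ρ → evalT t ρ ≡ evalT u ρ)
Defines-≡ t u = record
  { Tr⇔ = λ S ρ → mk⇔ (λ { (tr-≡ e) → e }) tr-≡
  ; Fl⇔ = λ S ρ → mk⇔ (λ { (fl-≡ e) → e }) fl-≡ }

Defines-Pair : ∀ {k} (p q z : Term k) → Defines (PairF p q z) (λ ρ → evalT z ρ ≡ pair (evalT p ρ) (evalT q ρ))
Defines-Pair p q z = Defines-cong (Defines-≡ _ _) (λ ρ → pair-equation (evalT p ρ) (evalT q ρ) (evalT z ρ))

module Definability (lem : ExcludedMiddle 0ℓ) where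

  private
    dne : ∀ {P : Set} → ¬ ¬ P → P
    dne = em⇒dne lem

  Defines-¬ : ∀ {k} {φ : Fm k} {P} → Defines φ P → Defines (`¬ φ) (λ ρ → ¬ P ρ)
  Defines-¬ d = record
    { Tr⇔ = λ S ρ → mk⇔ (to (Fl⇔ d S ρ) ∘ Tr-¬⁻¹) (tr-¬ ∘ from (Fl⇔ d S ρ))
    ; Fl⇔ = λ S ρ → mk⇔ (λ f ¬p → ¬p (to (Tr⇔ d S ρ) (Fl-¬⁻¹ f))) (fl-¬ ∘ from (Tr⇔ d S ρ) ∘ dne) }

  Defines-∧ : ∀ {k} {φ ψ : Fm k} {P Q} → Defines φ P → Defines ψ Q → Defines (φ `∧ ψ) (λ ρ → P ρ × Q ρ)
  Defines-∧ {P = P} {Q} d e = record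
    { Tr⇔ = λ S ρ → mk⇔ (λ { (tr-∧ t u) → to (Tr⇔ d S ρ) t , to (Tr⇔ e S ρ) u })
                        (λ (p , q) → tr-∧ (from (Tr⇔ d S ρ) p) (from (Tr⇔ e S ρ) q))
    ; Fl⇔ = λ S ρ → mk⇔ (λ { (fl-∧ˡ f) (p , _) → to (Fl⇔ d S ρ) f p ; (fl-∧ʳ f) (_ , q) → to (Fl⇔ e S ρ) f q })
                        (falsify S ρ) }
    where
    falsify : ∀ S ρ → ¬ (P ρ × Q ρ) → Fl S (_ `∧ _) ρ
    falsify S ρ ¬pq with lem {P ρ}
    ... | yes p = fl-∧ʳ (from (Fl⇔ e S ρ) (λ q → ¬pq (p , q)))
    ... | no ¬p = fl-∧ˡ (from (Fl⇔ d S ρ) ¬p)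

  Defines-∀ : ∀ {k} {φ : Fm (suc k)} {P} → Defines φ P → Defines (`∀ φ) (λ ρ → ∀ m → P (m ∷ ρ))
  Defines-∀ {P = P} d = record
    { Tr⇔ = λ S ρ → mk⇔ (λ { (tr-∀ t) m → to (Tr⇔ d S (m ∷ ρ)) (t m) })
                        (λ p → tr-∀ (λ m → from (Tr⇔ d S (m ∷ ρ)) (p m)))
    ; Fl⇔ = λ S ρ → mk⇔ (λ { (fl-∀ m f) p → to (Fl⇔ d S (m ∷ ρ)) f (p m) }) (falsify S ρ) }
    where
    falsify : ∀ S ρ → ¬ (∀ m → P (m ∷ ρ)) → Fl S (`∀ _) ρ
    falsify S ρ ¬∀p with lem {∃[ m ] ¬ P (m ∷ ρ)}
    ... | yes (m , ¬p) = fl-∀ m (from (Fl⇔ d S (m ∷ ρ)) ¬p)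
    ... | no ¬∃¬p      = contradiction (λ m → dne (λ ¬p → ¬∃¬p (m , ¬p))) ¬∀p

  Defines-∃ : ∀ {k} {φ : Fm (suc k)} {P} → Defines φ P → Defines (`∃ φ) (λ ρ → ∃[ m ] P (m ∷ ρ))
  Defines-∃ d = Defines-cong (Defines-¬ (Defines-∀ (Defines-¬ d))) (λ ρ →
    mk⇔ (λ ¬∀¬ → dne (λ ¬∃ → ¬∀¬ (λ m p → ¬∃ (m , p)))) (λ (m , p) ∀¬ → ∀¬ m p))

  Defines-⇒ : ∀ {k} {φ ψ : Fm k} {P Q} → Defines φ P → Defines ψ Q → Defines (φ `⇒ ψ) (λ ρ → P ρ → Q ρ)
  Defines-⇒ d e = Defines-cong (Defines-¬ (Defines-∧ d (Defines-¬ e))) (λ ρ →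
    mk⇔ (λ ¬[p∧¬q] p → dne (λ ¬q → ¬[p∧¬q] (p , ¬q))) (λ p⇒q (p , ¬q) → ¬q (p⇒q p)))

  Defines-Less : ∀ {k} (a b : Term k) → Defines (LessF a b) (λ ρ → evalT a ρ < evalT b ρ)
  Defines-Less a b = Defines-cong (Defines-∃ (Defines-≡ _ _)) (λ ρ → mk⇔ (less ρ) (witness ρ))
    where
    less : ∀ ρ → (∃[ m ] evalT (weaken a) (m ∷ ρ) + suc m ≡ evalT (weaken b) (m ∷ ρ)) → evalT a ρ < evalT b ρ
    less ρ (m , e) rewrite eval-weaken a m ρ | eval-weaken b m ρ | sym e =
      ≤-trans (s≤s (m≤m+n (evalT a ρ) m)) (≤-reflexive (sym (+-suc (evalT a ρ) m)))
    witness : ∀ ρ → evalT a ρ < evalT b ρ → ∃[ m ] evalT (weaken a) (m ∷ ρ) + suc m ≡ evalT (weaken b) (m ∷ ρ)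
    witness ρ a<b with m , e ← m≤n⇒∃[o]m+o≡n a<b =
      m , (begin
        evalT (weaken a) (m ∷ ρ) + suc m ≡⟨ cong (_+ suc m) (eval-weaken a m ρ) ⟩
        evalT a ρ + suc m                ≡⟨ +-suc (evalT a ρ) m ⟩
        suc (evalT a ρ + m)              ≡⟨ e ⟩
        evalT b ρ                        ≡⟨ eval-weaken b m ρ ⟨
        evalT (weaken b) (m ∷ ρ)         ∎)
      where open ≡-Reasoning

  Defines-Rem : ∀ {k} (a d r : Term k) → Defines (RemF a d r) (λ ρ → Rem (evalT a ρ) (evalT d ρ) (evalT r ρ))
  Defines-Rem a d r = Defines-cong (Defines-∧ (Defines-Less r d) (Defines-∃ (Defines-≡ _ _))) (λ ρ →
    mk⇔ (λ (lt , q , e) → lt , q , trans (sym (eval-weaken a q ρ)) (trans e (weakened q ρ)))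
        (λ (lt , q , e) → lt , q , trans (eval-weaken a q ρ) (trans e (sym (weakened q ρ)))))
    where
    weakened : ∀ q ρ → q * evalT (weaken d) (q ∷ ρ) + evalT (weaken r) (q ∷ ρ) ≡ q * evalT d ρ + evalT r ρ
    weakened q ρ = cong₂ (λ x y → q * x + y) (eval-weaken d q ρ) (eval-weaken r q ρ)

  Defines-β : ∀ {k} (a b i r : Term k) →
              Defines (βF a b i r) (λ ρ → Rem (evalT a ρ) (βmodulus (evalT b ρ) (evalT i ρ)) (evalT r ρ))
  Defines-β a b i r = Defines-Rem a (`suc (`suc i `* b)) r

  Defines-LetPair : ∀ {k} (p q : Term k) {φ : Fm (suc k)} {P} → Defines φ P →
                    Defines (LetPair p q φ) (λ ρ → P (pair (evalT p ρ) (evalT q ρ) ∷ ρ))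
  Defines-LetPair p q {P = P} d =
    Defines-cong (Defines-∃ (Defines-∧ (Defines-Pair (weaken p) (weaken q) (var fzero)) d))
    (λ ρ → mk⇔ (λ (m , e , x) → subst (λ z → P (z ∷ ρ)) (trans e (weakened m ρ)) x)
               (λ x → _ , sym (weakened _ ρ) , x))
    where
    weakened : ∀ m ρ → pair (evalT (weaken p) (m ∷ ρ)) (evalT (weaken q) (m ∷ ρ)) ≡
                       pair (evalT p ρ) (evalT q ρ)
    weakened m ρ = cong₂ pair (eval-weaken p m ρ) (eval-weaken q m ρ)

-- The diagonal lemma

-- w = numeralCode x, witnessed by a β-coded sequence (a , b) of the codes of the
-- numerals 0, …, x.
NumeralCodeF : ∀ {k} → Fin k → Fin k → Fm k
NumeralCodeF x w = `∃ (`∃ (βF (var (# 1)) (var (# 0)) (numeral 0) (numeral (numeralCode 0))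
  `∧ (`∀ (LessF (var (# 0)) (var (fsuc (fsuc (fsuc x)))) `⇒
           `∃ (`∃ (βF (var (# 4)) (var (# 3)) (var (# 2)) (var (# 1))
                  `∧ (βF (var (# 4)) (var (# 3)) (`suc (var (# 2))) (var (# 0))
                  `∧ PairF (numeral 2) (var (# 1)) (var (# 0))))))
  `∧ βF (var (# 1)) (var (# 0)) (var (fsuc (fsuc x))) (var (fsuc (fsuc w))))))

β-numeralCodes : ∀ a b x → Rem a (βmodulus b 0) (numeralCode 0) →
  (∀ i → i < x → ∃[ u ] ∃[ r ] Rem a (βmodulus b i) u × Rem a (βmodulus b (suc i)) r × r ≡ pair 2 u) →
  ∀ i → i ≤ x → Rem a (βmodulus b i) (numeralCode i)
β-numeralCodes a b x rem₀ step zero    _   = rem₀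
β-numeralCodes a b x rem₀ step (suc i) i<x with u , r , remᵤ , remᵣ , refl ← step i i<x
  rewrite Rem-functional remᵤ (β-numeralCodes a b x rem₀ step i (≤-trans (n≤1+n i) i<x)) = remᵣ

diagCode : ℕ → ℕ → ℕ
diagCode w c = pair 4 (pair 2 (pair 3 (pair (pair 0 (pair (pair 0 0) w)) (pair 2 c))))

-- In context (w , z , c) this says z = diagCode w c; each LetPair pushes one more
-- component of the code, built from the inside out.
DiagCodeF : Fm 3
DiagCodeF =
  LetPair (numeral (pair 0 0)) (var (# 0))
  (LetPair (numeral 0) (var (# 0))
  (LetPair (numeral 2) (var (# 4))
  (LetPair (var (# 1)) (var (# 0))
  (LetPair (numeral 3) (var (# 0))
  (LetPair (numeral 2) (var (# 0))
  (PairF (numeral 4) (var (# 0)) (var (# 7))))))))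

opaque
  SubF : Fm 2
  SubF = `∃ (NumeralCodeF (# 2) (# 0) `∧ DiagCodeF)

module _ (lem : ExcludedMiddle 0ℓ) where
  open Definability lem

  Defines-NumeralCode : ∀ {k} (x w : Fin k) →
                        Defines (NumeralCodeF x w) (λ ρ → lookup ρ w ≡ numeralCode (lookup ρ x))
  Defines-NumeralCode x w = Defines-cong
    (Defines-∃ (Defines-∃ (Defines-∧ (Defines-β _ _ _ _)
      (Defines-∧ (Defines-∀ (Defines-⇒ (Defines-Less _ _)
                   (Defines-∃ (Defines-∃ (Defines-∧ (Defines-β _ _ _ _)
                     (Defines-∧ (Defines-β _ _ _ _) (Defines-Pair _ _ _)))))))
                 (Defines-β _ _ _ _)))))
    (λ ρ → mk⇔ (λ (a , b , rem₀ , step , remₓ) →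
                  Rem-functional remₓ (β-numeralCodes a b (lookup ρ x) rem₀ step (lookup ρ x) ≤-refl))
               (witness ρ))
    where
    witness : ∀ ρ → lookup ρ w ≡ numeralCode (lookup ρ x) → _
    witness ρ e with a , b , rem ← β-lemma numeralCode (lookup ρ x) =
      a , b , rem 0 z≤n
        , (λ i i<x → numeralCode i , numeralCode (suc i)
                     , rem i (≤-trans (n≤1+n i) i<x) , rem (suc i) i<x , refl)
        , subst (Rem a (βmodulus b (lookup ρ x))) (sym e) (rem (lookup ρ x) ≤-refl)

  Defines-DiagCode : Defines DiagCodeF (λ ρ → lookup ρ (# 1) ≡ diagCode (lookup ρ (# 0)) (lookup ρ (# 2)))
  Defines-DiagCode =
    Defines-LetPair _ _ (Defines-LetPair _ _ (Defines-LetPair _ _ (Defines-LetPair _ _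
    (Defines-LetPair _ _ (Defines-LetPair _ _ (Defines-Pair _ _ _))))))

  opaque
    unfolding SubF
    Defines-Sub : Defines SubF
                    (λ ρ → lookup ρ (# 0) ≡ diagCode (numeralCode (lookup ρ (# 1))) (lookup ρ (# 1)))
    Defines-Sub = Defines-cong (Defines-∃ (Defines-∧ (Defines-NumeralCode (# 2) (# 0)) Defines-DiagCode))
      (λ ρ → mk⇔ (λ { (w , refl , e) → e }) (λ e → _ , refl , e))

-- σ = ∀x ¬(x = c ∧ ¬ B x) says B c, where c is the code of B y = ∃z (Sub z y ∧ D z y)
-- and Sub z c holds exactly when z is the code of σ.  So σ says D (code σ) c.
module Diagonal (D : Fm 2) where

  B : Fm 1
  B = `∃ (SubF `∧ D)

  opaque
    c : ℕ
    c = code B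

    code-B : code B ≡ c
    code-B = refl

  E : Fm 1
  E = var fzero `≡ numeral c

  body : Fm 1
  body = `¬ (E `∧ `¬ B)

  σ : Sentence
  σ = `∀ body

  -- The implicit arguments spare Agda from inverting the huge codes.
  code-σ : code σ ≡ diagCode (numeralCode c) c
  code-σ = cong₂ diagCode {codeT (numeral {1} c)} {numeralCode c} {code B} {c} (codeT-numeral c) code-B

  σ-Tr⇔B : ∀ S → Tr S σ [] ⇔ Tr S B (c ∷ [])
  σ-Tr⇔B S = mk⇔ (λ { (tr-∀ t) → at-c (t c) }) (λ t → tr-∀ (λ m → instance-at m (m ≟ c) t))
    where
    at-c : Tr S body (c ∷ []) → Tr S B (c ∷ [])
    at-c (tr-¬ (fl-∧ˡ (fl-≡ c≢c))) = contradiction (sym (eval-numeral c (c ∷ []))) c≢c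
    at-c (tr-¬ (fl-∧ʳ (fl-¬ t)))   = t
    instance-at : ∀ m → Dec (m ≡ c) → Tr S B (c ∷ []) → Tr S body (m ∷ [])
    instance-at m (yes refl) t = tr-¬ (fl-∧ʳ (fl-¬ t))
    instance-at m (no m≢c)   _ = tr-¬ (fl-∧ˡ (fl-≡ (λ e → m≢c (trans e (eval-numeral c (m ∷ []))))))

  σ-Fl⇔B : ∀ S → Fl S σ [] ⇔ Fl S B (c ∷ [])
  σ-Fl⇔B S = mk⇔ (λ { (fl-∀ m (fl-¬ (tr-∧ (tr-≡ e) (tr-¬ f)))) →
                       subst (λ n → Fl S B (n ∷ [])) (trans e (eval-numeral c (m ∷ []))) f })
                 (λ f → fl-∀ c (fl-¬ (tr-∧ (tr-≡ (sym (eval-numeral c (c ∷ [])))) (tr-¬ f))))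

  module _ (lem : ExcludedMiddle 0ℓ) where

    private
      Sub-σ : ∀ S → Tr S SubF (code σ ∷ c ∷ [])
      Sub-σ S = from (Tr⇔ (Defines-Sub lem) S (code σ ∷ c ∷ [])) code-σ

      Sub⇒σ : ∀ S z → Tr S SubF (z ∷ c ∷ []) → z ≡ code σ
      Sub⇒σ S z t = trans (to (Tr⇔ (Defines-Sub lem) S (z ∷ c ∷ [])) t) (sym code-σ)

      ¬Sub : ∀ S z → z ≢ code σ → Fl S SubF (z ∷ c ∷ [])
      ¬Sub S z z≢σ = from (Fl⇔ (Defines-Sub lem) S (z ∷ c ∷ [])) (λ e → z≢σ (trans e (sym code-σ)))

    B-Tr⇔D : ∀ S → Tr S B (c ∷ []) ⇔ Tr S D (code σ ∷ c ∷ [])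
    B-Tr⇔D S = mk⇔
      (λ { (tr-¬ (fl-∀ z (fl-¬ (tr-∧ s t)))) → subst (λ n → Tr S D (n ∷ c ∷ [])) (Sub⇒σ S z s) t })
                   (λ t → tr-¬ (fl-∀ (code σ) (fl-¬ (tr-∧ (Sub-σ S) t))))

    B-Fl⇔D : ∀ S → Fl S B (c ∷ []) ⇔ Fl S D (code σ ∷ c ∷ [])
    B-Fl⇔D S = mk⇔ (λ { (fl-¬ (tr-∀ t)) → at-σ (t (code σ)) })
                   (λ f → fl-¬ (tr-∀ (λ z → instance-at z (z ≟ code σ) f)))
      where
      at-σ : Tr S (`¬ (SubF `∧ D)) (code σ ∷ c ∷ []) → Fl S D (code σ ∷ c ∷ [])
      at-σ (tr-¬ (fl-∧ˡ f)) = contradiction code-σ (to (Fl⇔ (Defines-Sub lem) S (code σ ∷ c ∷ [])) f)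
      at-σ (tr-¬ (fl-∧ʳ f)) = f
      instance-at : ∀ z → Dec (z ≡ code σ) → Fl S D (code σ ∷ c ∷ []) → Tr S (`¬ (SubF `∧ D)) (z ∷ c ∷ [])
      instance-at z (yes refl) f = tr-¬ (fl-∧ʳ f)
      instance-at z (no z≢σ)   _ = tr-¬ (fl-∧ˡ (¬Sub S z z≢σ))

    diagonal-Tr : ∀ S → Tr S σ [] ⇔ Tr S D (code σ ∷ c ∷ [])
    diagonal-Tr S = B-Tr⇔D S ⇔-∘ σ-Tr⇔B S

    diagonal-Fl : ∀ S → Fl S σ [] ⇔ Fl S D (code σ ∷ c ∷ [])
    diagonal-Fl S = B-Fl⇔D S ⇔-∘ σ-Fl⇔B S

-- Truth-tellers and the liar

TruthTellerF : ℕ → Fm 2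
TruthTellerF j = `True (var fzero) `∧ (numeral j `≡ numeral j)

LiarF : Fm 2
LiarF = `¬ (`True (var fzero))

-- The numeral j in TruthTellerF j only serves to make the truth-tellers distinct.
τ : ℕ → Sentence
τ j = Diagonal.σ (TruthTellerF j)

λ-liar : Sentence
λ-liar = Diagonal.σ LiarF

diagonalised : Sentence → Fm 2
diagonalised (`∀ (`¬ (_ `∧ `¬ (`¬ (`∀ (`¬ (_ `∧ D))))))) = D
diagonalised _ = `zero `≡ `zero

numeral-injective : ∀ {k} m n → numeral {k} m ≡ numeral n → m ≡ n
numeral-injective {k} m n e =
  trans (sym (eval-numeral {k} m (replicate k 0)))
        (trans (cong (λ t → evalT t (replicate k 0)) e) (eval-numeral n _))

τ-injective : ∀ {i j} → code (τ i) ≡ code (τ j) → i ≡ j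
τ-injective {i} {j} e = numeral-injective i j (cong (lhs ∘ diagonalised) (code-injective (τ i) (τ j) e))
  where
  lhs : Fm 2 → Term 2
  lhs (_ `∧ (t `≡ _)) = t
  lhs _ = `zero

τ≢¬ : ∀ j (ψ : Sentence) → code (τ j) ≢ code (`¬ ψ)
τ≢¬ j ψ e = ∀≢¬ (code-injective (τ j) (`¬ ψ) e)
  where
  ∀≢¬ : ∀ {φ ψ} → `∀ φ ≢ `¬ ψ
  ∀≢¬ ()

module _ (lem : ExcludedMiddle 0ℓ) where

  private
    ¬-code-cong : ∀ (S : ℕ → Bool) (φ ψ : Sentence) → code φ ≡ code ψ →
                  S (code (`¬ φ)) ≡ true → S (code (`¬ ψ)) ≡ true
    ¬-code-cong S φ ψ e = subst (λ n → S (pair 2 n) ≡ true) e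

  τ-Tr⇔ : ∀ S j → Tr S (τ j) [] ⇔ S (code (τ j)) ≡ true
  τ-Tr⇔ S j = mk⇔ (λ t → in-S (to (Diagonal.diagonal-Tr (TruthTellerF j) lem S) t))
                  (λ s → from (Diagonal.diagonal-Tr (TruthTellerF j) lem S) (tr-∧ (tr-True s) (tr-≡ refl)))
    where
    in-S : Tr S (TruthTellerF j) _ → S (code (τ j)) ≡ true
    in-S (tr-∧ (tr-True s) _) = s

  τ-Fl⇔ : ∀ S j → Fl S (τ j) [] ⇔ S (code (`¬ (τ j))) ≡ true
  τ-Fl⇔ S j = mk⇔ (λ f → ¬-in-S (to (Diagonal.diagonal-Fl (TruthTellerF j) lem S) f))
                  (λ s → from (Diagonal.diagonal-Fl (TruthTellerF j) lem S) (fl-∧ˡ (fl-negIn (τ j) refl s)))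
    where
    ¬-in-S : Fl S (TruthTellerF j) _ → S (code (`¬ (τ j))) ≡ true
    ¬-in-S (fl-∧ˡ (fl-nonSent no-code)) = contradiction (τ j , refl) no-code
    ¬-in-S (fl-∧ˡ (fl-negIn φ e s))     = ¬-code-cong S φ (τ j) e s
    ¬-in-S (fl-∧ʳ (fl-≡ j≢j))           = contradiction refl j≢j

  liar-Tr : ∀ S → Tr S λ-liar [] → S (code (`¬ λ-liar)) ≡ true
  liar-Tr S t = ¬-in-S (to (Diagonal.diagonal-Tr LiarF lem S) t)
    where
    ¬-in-S : Tr S LiarF _ → S (code (`¬ λ-liar)) ≡ true
    ¬-in-S (tr-¬ (fl-nonSent no-code)) = contradiction (λ-liar , refl) no-code
    ¬-in-S (tr-¬ (fl-negIn φ e s))     = ¬-code-cong S φ λ-liar e s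

  liar-Fl : ∀ S → Fl S λ-liar [] → S (code λ-liar) ≡ true
  liar-Fl S f = in-S (to (Diagonal.diagonal-Fl LiarF lem S) f)
    where
    in-S : Fl S LiarF _ → S (code λ-liar) ≡ true
    in-S (fl-¬ (tr-True s)) = s

-- Fixed points with prescribed truth-teller values

data V3 : Set where
  vT vF vN : V3

T≢F : vT ≢ vF
T≢F ()

N≢T : vN ≢ vT
N≢T ()

N≢F : vN ≢ vF
N≢F ()

HasValue : FIX → Sentence → V3 → Set
HasValue w φ t = (TrueIn (proj₁ w) φ ⇔ t ≡ vT) × (FalseIn (proj₁ w) φ ⇔ t ≡ vF)

-- The value of a sentence φ in a fixed point S, from S (code φ) and S (code (¬ φ)).
value₃ : Bool → Bool → V3
value₃ true  _     = vT
value₃ false true  = vF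
value₃ false false = vN

value₃-T : ∀ a b → value₃ a b ≡ vT ⇔ a ≡ true
value₃-T true  b     = mk⇔ (λ _ → refl) (λ _ → refl)
value₃-T false true  = mk⇔ (λ ()) (λ ())
value₃-T false false = mk⇔ (λ ()) (λ ())

value₃-F : ∀ a b → value₃ a b ≡ vF ⇔ (a ≡ false × b ≡ true)
value₃-F true  b     = mk⇔ (λ ()) (λ { (() , _) })
value₃-F false true  = mk⇔ (λ _ → refl , refl) (λ _ → refl)
value₃-F false false = mk⇔ (λ ()) (λ { (_ , ()) })

τ-value : FIX → ℕ → V3
τ-value (S , _) j = value₃ (S (code (τ j))) (S (code (`¬ (τ j))))

module _ (lem : ExcludedMiddle 0ℓ) where

  τ-HasValue : ∀ w j → HasValue w (τ j) (τ-value w j)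
  τ-HasValue w@(S , _) j =
      ⇔-sym (value₃-T (S (code (τ j))) _) ⇔-∘ τ-Tr⇔ lem S j
    , mk⇔ (λ f → from (value₃-F _ _) ( ¬-not (λ s → fixed-Tr⇒¬Fl w (from (τ-Tr⇔ lem S j) s) f)
                                      , to (τ-Fl⇔ lem S j) f))
          (λ e → from (τ-Fl⇔ lem S j) (proj₂ (to (value₃-F _ _) e)))

  liar-HasValue : ∀ w → HasValue w λ-liar vN
  liar-HasValue w@(S , _) = mk⇔ (⊥-elim ∘ not-true) (λ ()) , mk⇔ (⊥-elim ∘ not-false) (λ ())
    where
    not-true : ¬ TrueIn S λ-liar
    not-true t = fixed-Tr⇒¬Fl w t (Tr-¬⁻¹ (fixed-∈⇒Tr w (`¬ λ-liar) (liar-Tr lem S t)))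
    not-false : ¬ FalseIn S λ-liar
    not-false f = fixed-Tr⇒¬Fl w (fixed-∈⇒Tr w λ-liar (liar-Fl lem S f)) f

-- Seed the least fixed point with τ j or ¬ τ j according to v j.  Induction along the
-- least fixed point shows that it never contains a truth-teller (or its negation) that
-- v does not ask for.
module Prescribed (lem : ExcludedMiddle 0ℓ) (v : ℕ → V3) where

  Seed : ℕ → Set
  Seed n = ∃[ j ] ((v j ≡ vT × n ≡ code (τ j)) ⊎ (v j ≡ vF × n ≡ code (`¬ (τ j))))

  Excluded : ℕ → Set
  Excluded n = ∃[ j ] ((v j ≢ vT × n ≡ code (τ j)) ⊎ (v j ≢ vF × n ≡ code (`¬ (τ j))))

  S₀ : ℕ → Bool
  S₀ n = does (lem {Seed n})

  S₀-sound : ∀ n → S₀ n ≡ true → Jump S₀ n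
  S₀-sound n s = seed-sound n s (dec-true⁻¹ lem s)
    where
    seed-sound : ∀ n → S₀ n ≡ true → Seed n → Jump S₀ n
    seed-sound _ s (j , inj₁ (_ , refl)) = τ j , refl , from (τ-Tr⇔ lem S₀ j) s
    seed-sound _ s (j , inj₂ (_ , refl)) = `¬ (τ j) , refl , tr-¬ (from (τ-Fl⇔ lem S₀ j) s)

  Seed⇒¬Excluded : ∀ n → Seed n → ¬ Excluded n
  Seed⇒¬Excluded _ (j , inj₁ (≡T , refl)) (k , inj₁ (¬T , e)) = ¬T (subst (λ i → v i ≡ vT) (τ-injective e) ≡T)
  Seed⇒¬Excluded _ (j , inj₁ (_ , refl)) (k , inj₂ (_ , e))  = τ≢¬ j (τ k) e
  Seed⇒¬Excluded _ (j , inj₂ (_ , refl)) (k , inj₁ (_ , e))  = τ≢¬ k (τ j) (sym e)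
  Seed⇒¬Excluded _ (j , inj₂ (≡F , refl)) (k , inj₂ (¬F , e)) =
    ¬F (subst (λ i → v i ≡ vF) (τ-injective (proj₂ (pair-injective {2} {code (τ j)} {2} {code (τ k)} e))) ≡F)

  open LeastClosed lem S₀
  open FixedPoint S₀-sound

  private
    Q : ℕ → Bool
    Q n = does (lem {L n ≡ true × ¬ Excluded n})

    Q⊆L : Q ⊆ᵇ L
    Q⊆L n q = proj₁ (dec-true⁻¹ lem q)

    Tr-Q⇒¬Excluded : ∀ φ → TrueIn Q φ → ¬ Excluded (code φ)
    Tr-Q⇒¬Excluded φ t (k , inj₁ (¬T , e)) =
      proj₂ (dec-true⁻¹ lem (to (τ-Tr⇔ lem Q k) (subst (TrueIn Q) (code-injective φ (τ k) e) t)))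
            (k , inj₁ (¬T , refl))
    Tr-Q⇒¬Excluded φ t (k , inj₂ (¬F , e)) =
      proj₂ (dec-true⁻¹ lem (to (τ-Fl⇔ lem Q k) (Tr-¬⁻¹ (subst (TrueIn Q) (code-injective φ (`¬ (τ k)) e) t))))
            (k , inj₂ (¬F , refl))

    Q-closed : Closed Q
    Q-closed n (inj₂ s) = dec-true lem (S₀⊆L n s , Seed⇒¬Excluded n (dec-true⁻¹ lem s))
    Q-closed _ (inj₁ (φ , refl , t)) =
      dec-true lem (L-closed _ (inj₁ (Jump-mono Q⊆L _ (φ , refl , t))) , Tr-Q⇒¬Excluded φ t)

  L-avoids-Excluded : ∀ n → L n ≡ true → ¬ Excluded n
  L-avoids-Excluded n l = proj₂ (dec-true⁻¹ lem (L-least Q Q-closed n l))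

  private
    S₀-¬L : ∀ (ψ : Sentence) → S₀ (code ψ) ≡ true → L (code (`¬ ψ)) ≡ true → ⊥
    S₀-¬L ψ s l = conflict (dec-true⁻¹ lem s)
      where
      conflict : Seed (code ψ) → ⊥
      conflict (j , inj₁ (≡T , e)) =
        L-avoids-Excluded _ l (j , inj₂ ((λ ≡F → T≢F (trans (sym ≡T) ≡F)) , cong (pair 2) e))
      conflict (j , inj₂ (≡F , e)) =
        L-avoids-Excluded _ (to (τ-Tr⇔ lem L j) (Fl-¬⁻¹ (subst (FalseIn L) (code-injective ψ (`¬ (τ j)) e)
                                                             (Tr-¬⁻¹ (L⇒Tr (`¬ ψ) l)))))
                          (j , inj₁ ((λ ≡T → T≢F (trans (sym ≡T) ≡F)) , refl))

    ¬S₀-L : ∀ (ψ : Sentence) → S₀ (code (`¬ ψ)) ≡ true → L (code ψ) ≡ true → ⊥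
    ¬S₀-L ψ s l = conflict (dec-true⁻¹ lem s)
      where
      conflict : Seed (code (`¬ ψ)) → ⊥
      conflict (j , inj₁ (_ , e)) = τ≢¬ j ψ (sym e)
      conflict (j , inj₂ (≡F , e)) =
        L-avoids-Excluded _ l (j , inj₁ ( (λ ≡T → T≢F (trans (sym ≡T) ≡F))
                                        , proj₂ (pair-injective {2} {code ψ} {2} {code (τ j)} e)))

  open Consistent S₀-¬L ¬S₀-L public using (fixed-point)

  τ-value-fixed-point : ∀ j → τ-value fixed-point j ≡ v j
  τ-value-fixed-point j = value-at (v j) refl
    where
    not-in-L : ∀ {n} → Excluded n → L n ≡ false
    not-in-L excluded = ¬-not (λ l → L-avoids-Excluded _ l excluded)
    value-at : ∀ t → v j ≡ t → τ-value fixed-point j ≡ t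
    value-at vT e = from (value₃-T _ _) (S₀⊆L _ (dec-true lem (j , inj₁ (e , refl))))
    value-at vF e = from (value₃-F _ _)
      ( not-in-L (j , inj₁ ((λ ≡T → T≢F (trans (sym ≡T) e)) , refl))
      , S₀⊆L _ (dec-true lem (j , inj₂ (e , refl))))
    value-at vN e = cong₂ value₃ (not-in-L (j , inj₁ ((λ ≡T → N≢T (trans (sym e) ≡T)) , refl)))
                                 (not-in-L (j , inj₂ ((λ ≡F → N≢F (trans (sym e) ≡F)) , refl)))

prescribed-fixed-point : ExcludedMiddle 0ℓ → (v : ℕ → V3) → Σ[ w ∈ FIX ] (∀ j → τ-value w j ≡ v j)
prescribed-fixed-point lem v = Prescribed.fixed-point lem v , Prescribed.τ-value-fixed-point lem v

-- Sentences with prescribed values in all fixed points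

infixr 6 _∧₃_
infixr 5 _∨₃_

¬₃ : V3 → V3
¬₃ vT = vF
¬₃ vF = vT
¬₃ vN = vN

_∧₃_ : V3 → V3 → V3
vF ∧₃ _  = vF
vT ∧₃ y  = y
vN ∧₃ vF = vF
vN ∧₃ vT = vN
vN ∧₃ vN = vN

_∨₃_ : V3 → V3 → V3
x ∨₃ y = ¬₃ (¬₃ x ∧₃ ¬₃ y)

¬₃-T : ∀ t → ¬₃ t ≡ vT ⇔ t ≡ vF
¬₃-T vT = mk⇔ (λ ()) (λ ())
¬₃-T vF = mk⇔ (λ _ → refl) (λ _ → refl)
¬₃-T vN = mk⇔ (λ ()) (λ ())

¬₃-F : ∀ t → ¬₃ t ≡ vF ⇔ t ≡ vT
¬₃-F vT = mk⇔ (λ _ → refl) (λ _ → refl)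
¬₃-F vF = mk⇔ (λ ()) (λ ())
¬₃-F vN = mk⇔ (λ ()) (λ ())

∧₃-T : ∀ t s → t ∧₃ s ≡ vT ⇔ (t ≡ vT × s ≡ vT)
∧₃-T vT s  = mk⇔ (refl ,_) proj₂
∧₃-T vF s  = mk⇔ (λ ()) (λ { (() , _) })
∧₃-T vN vF = mk⇔ (λ ()) (λ { (() , _) })
∧₃-T vN vT = mk⇔ (λ ()) (λ { (() , _) })
∧₃-T vN vN = mk⇔ (λ ()) (λ { (() , _) })

∧₃-F : ∀ t s → t ∧₃ s ≡ vF ⇔ (t ≡ vF ⊎ s ≡ vF)
∧₃-F vF s  = mk⇔ inj₁ (λ _ → refl)
∧₃-F vT s  = mk⇔ inj₂ (λ { (inj₁ ()) ; (inj₂ e) → e })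
∧₃-F vN vF = mk⇔ inj₂ (λ _ → refl)
∧₃-F vN vT = mk⇔ (λ ()) (λ { (inj₁ ()) ; (inj₂ ()) })
∧₃-F vN vN = mk⇔ (λ ()) (λ { (inj₁ ()) ; (inj₂ ()) })

HasValue-¬ : ∀ {w φ t} → HasValue w φ t → HasValue w (`¬ φ) (¬₃ t)
HasValue-¬ {t = t} (T⇔ , F⇔) =
    mk⇔ (from (¬₃-T t) ∘ to F⇔ ∘ Tr-¬⁻¹) (tr-¬ ∘ from F⇔ ∘ to (¬₃-T t))
  , mk⇔ (from (¬₃-F t) ∘ to T⇔ ∘ Fl-¬⁻¹) (fl-¬ ∘ from T⇔ ∘ to (¬₃-F t))

HasValue-∧ : ∀ {w φ ψ t s} → HasValue w φ t → HasValue w ψ s → HasValue w (φ `∧ ψ) (t ∧₃ s)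
HasValue-∧ {w} {φ} {ψ} {t} {s} (T⇔ , F⇔) (T⇔′ , F⇔′) =
    mk⇔ (λ { (tr-∧ a b) → from (∧₃-T t s) (to T⇔ a , to T⇔′ b) })
        (λ e → let (a , b) = to (∧₃-T t s) e in tr-∧ (from T⇔ a) (from T⇔′ b))
  , mk⇔ (λ { (fl-∧ˡ f) → from (∧₃-F t s) (inj₁ (to F⇔ f)) ; (fl-∧ʳ f) → from (∧₃-F t s) (inj₂ (to F⇔′ f)) })
        (falsify ∘ to (∧₃-F t s))
  where
  falsify : t ≡ vF ⊎ s ≡ vF → FalseIn (proj₁ w) (φ `∧ ψ)
  falsify (inj₁ e) = fl-∧ˡ (from F⇔ e)
  falsify (inj₂ e) = fl-∧ʳ (from F⇔′ e)

infixr 7 ¬ᶜ_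
infixr 6 _∧ᶜ_
infixr 5 _∨ᶜ_

data Compound : Set where
  τᶜ   : ℕ → Compound
  liar : Compound
  ⊤ᶜ   : Compound
  ¬ᶜ_  : Compound → Compound
  _∧ᶜ_ : Compound → Compound → Compound

⊥ᶜ : Compound
⊥ᶜ = ¬ᶜ ⊤ᶜ

_∨ᶜ_ : Compound → Compound → Compound
p ∨ᶜ q = ¬ᶜ (¬ᶜ p ∧ᶜ ¬ᶜ q)

⟦_⟧ᶜ : Compound → Sentence
⟦ τᶜ j ⟧ᶜ   = τ j
⟦ liar ⟧ᶜ   = λ-liar
⟦ ⊤ᶜ ⟧ᶜ     = `zero `≡ `zero
⟦ ¬ᶜ p ⟧ᶜ   = `¬ ⟦ p ⟧ᶜ
⟦ p ∧ᶜ q ⟧ᶜ = ⟦ p ⟧ᶜ `∧ ⟦ q ⟧ᶜ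

evalᶜ : (ℕ → V3) → Compound → V3
evalᶜ vv (τᶜ j)   = vv j
evalᶜ vv liar     = vN
evalᶜ vv ⊤ᶜ       = vT
evalᶜ vv (¬ᶜ p)   = ¬₃ (evalᶜ vv p)
evalᶜ vv (p ∧ᶜ q) = evalᶜ vv p ∧₃ evalᶜ vv q

Compound-HasValue : ExcludedMiddle 0ℓ → ∀ w p → HasValue w ⟦ p ⟧ᶜ (evalᶜ (τ-value w) p)
Compound-HasValue lem w (τᶜ j)   = τ-HasValue lem w j
Compound-HasValue lem w liar     = liar-HasValue lem w
Compound-HasValue lem w ⊤ᶜ       =
  mk⇔ (λ _ → refl) (λ _ → tr-≡ refl) , mk⇔ (λ { (fl-≡ 0≢0) → contradiction refl 0≢0 }) (λ ())
Compound-HasValue lem w (¬ᶜ p)   = HasValue-¬ {w} {⟦ p ⟧ᶜ} (Compound-HasValue lem w p)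
Compound-HasValue lem w (p ∧ᶜ q) =
  HasValue-∧ {w} {⟦ p ⟧ᶜ} {⟦ q ⟧ᶜ} (Compound-HasValue lem w p) (Compound-HasValue lem w q)

shiftᶜ : Compound → Compound
shiftᶜ (τᶜ j)   = τᶜ (suc j)
shiftᶜ liar     = liar
shiftᶜ ⊤ᶜ       = ⊤ᶜ
shiftᶜ (¬ᶜ p)   = ¬ᶜ shiftᶜ p
shiftᶜ (p ∧ᶜ q) = shiftᶜ p ∧ᶜ shiftᶜ q

evalᶜ-shift : ∀ vv p → evalᶜ vv (shiftᶜ p) ≡ evalᶜ (vv ∘ suc) p
evalᶜ-shift vv (τᶜ j)   = refl
evalᶜ-shift vv liar     = refl
evalᶜ-shift vv ⊤ᶜ       = refl
evalᶜ-shift vv (¬ᶜ p)   = cong ¬₃ (evalᶜ-shift vv p)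
evalᶜ-shift vv (p ∧ᶜ q) = cong₂ _∧₃_ (evalᶜ-shift vv p) (evalᶜ-shift vv q)

-- Among τ 0, …, τ (m - 1), the first one that is not false, provided it is true.
scan : (ℕ → V3) → (m : ℕ) → Maybe (Fin m)
scan vv zero    = nothing
scan vv (suc m) with vv 0
... | vT = just fzero
... | vF = Maybe.map fsuc (scan (vv ∘ suc) m)
... | vN = nothing

firstTrueAt : ∀ {m} → Fin m → ℕ → V3
firstTrueAt fzero    _       = vT
firstTrueAt (fsuc i) zero    = vF
firstTrueAt (fsuc i) (suc j) = firstTrueAt i j

scan-firstTrueAt : ∀ {m} vv (i : Fin m) → (∀ j → vv j ≡ firstTrueAt i j) → scan vv m ≡ just i
scan-firstTrueAt {suc m} vv fzero    vv≗ rewrite vv≗ 0 = refl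
scan-firstTrueAt {suc m} vv (fsuc i) vv≗ rewrite vv≗ 0 | scan-firstTrueAt (vv ∘ suc) i (vv≗ ∘ suc) = refl

_≡ᵇ₃_ : V3 → V3 → Bool
vT ≡ᵇ₃ vT = true
vF ≡ᵇ₃ vF = true
vN ≡ᵇ₃ vN = true
_  ≡ᵇ₃ _  = false

⌊_⌋ᶜ : Bool → Compound
⌊ true ⌋ᶜ  = ⊤ᶜ
⌊ false ⌋ᶜ = ⊥ᶜ

bool₃ : Bool → V3
bool₃ true  = vT
bool₃ false = vF

evalᶜ-⌊⌋ : ∀ vv b → evalᶜ vv ⌊ b ⌋ᶜ ≡ bool₃ b
evalᶜ-⌊⌋ vv true  = refl
evalᶜ-⌊⌋ vv false = refl

Chooses : ∀ {m} → (Fin m → V3) → V3 → Compound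
Chooses {zero}  W t = ⊥ᶜ
Chooses {suc m} W t = (τᶜ 0 ∧ᶜ ⌊ W fzero ≡ᵇ₃ t ⌋ᶜ) ∨ᶜ (¬ᶜ τᶜ 0 ∧ᶜ shiftᶜ (Chooses (W ∘ fsuc) t))

Chooses-just : ∀ {m} vv (W : Fin m → V3) t i → scan vv m ≡ just i → evalᶜ vv (Chooses W t) ≡ bool₃ (W i ≡ᵇ₃ t)
Chooses-just {suc m} vv W t i eq with vv 0
... | vT with refl ← eq rewrite evalᶜ-⌊⌋ vv (W fzero ≡ᵇ₃ t) with W fzero ≡ᵇ₃ t
...   | true  = refl
...   | false = refl
Chooses-just {suc m} vv W t i eq | vF with scan (vv ∘ suc) m in e
Chooses-just {suc m} vv W t (fsuc i) refl | vF | just .i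
  rewrite evalᶜ-shift vv (Chooses (W ∘ fsuc) t) | Chooses-just (vv ∘ suc) (W ∘ fsuc) t i e
  with W (fsuc i) ≡ᵇ₃ t
... | true  = refl
... | false = refl

Chooses-nothing : ∀ {m} vv (W : Fin m → V3) t → scan vv m ≡ nothing → evalᶜ vv (Chooses W t) ≢ vT
Chooses-nothing {zero} vv W t _ ()
Chooses-nothing {suc m} vv W t eq with vv 0
... | vF with scan (vv ∘ suc) m in e
...   | nothing rewrite evalᶜ-shift vv (Chooses (W ∘ fsuc) t) =
  not-true (Chooses-nothing (vv ∘ suc) (W ∘ fsuc) t e)
  where
  not-true : ∀ {x} → x ≢ vT → (vF ∧₃ evalᶜ vv ⌊ W fzero ≡ᵇ₃ t ⌋ᶜ) ∨₃ (vT ∧₃ x) ≢ vT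
  not-true {vT} x≢T = contradiction refl x≢T
  not-true {vF} _ ()
  not-true {vN} _ ()
Chooses-nothing {suc m} vv W t eq | vN
  rewrite evalᶜ-⌊⌋ vv (W fzero ≡ᵇ₃ t) = blocked (W fzero ≡ᵇ₃ t) (evalᶜ vv (shiftᶜ (Chooses (W ∘ fsuc) t)))
  where
  blocked : ∀ c r → (vN ∧₃ bool₃ c) ∨₃ (¬₃ vN ∧₃ r) ≢ vT
  blocked true  vT ()
  blocked true  vF ()
  blocked true  vN ()
  blocked false vT ()
  blocked false vF ()
  blocked false vN ()

-- With b neither, the liar keeps the value neither unless the scan chooses some W i.
Selector : V3 → ∀ {m} → (Fin m → V3) → Compound
Selector vT W = ⊤ᶜ
Selector vF W = ⊥ᶜ
Selector vN W = (Chooses W vT ∨ᶜ liar) ∧ᶜ ¬ᶜ Chooses W vF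

Selector-value : ∀ b {m} (W : Fin m → V3) → (∀ i → b ≡ vN ⊎ b ≡ W i) →
                 ∀ vv → evalᶜ vv (Selector b W) ≡ maybe′ W b (scan vv m)
Selector-value b {m} W compatible vv with scan vv m in e
Selector-value vT W compatible vv | just i with compatible i
... | inj₂ T≡Wi = T≡Wi
Selector-value vF W compatible vv | just i with compatible i
... | inj₂ F≡Wi = F≡Wi
Selector-value vN W compatible vv | just i
  rewrite Chooses-just vv W vT i e | Chooses-just vv W vF i e with W i
... | vT = refl
... | vF = refl
... | vN = refl
Selector-value vT W compatible vv | nothing = refl
Selector-value vF W compatible vv | nothing = refl
Selector-value vN W compatible vv | nothing =
  neither (evalᶜ vv (Chooses W vT)) (evalᶜ vv (Chooses W vF))
          (Chooses-nothing vv W vT e) (Chooses-nothing vv W vF e)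
  where
  neither : ∀ d f → d ≢ vT → f ≢ vT → (d ∨₃ vN) ∧₃ ¬₃ f ≡ vN
  neither vT _  d≢T _   = contradiction refl d≢T
  neither _  vT _   f≢T = contradiction refl f≢T
  neither vF vF _ _ = refl
  neither vF vN _ _ = refl
  neither vN vF _ _ = refl
  neither vN vN _ _ = refl

module Realizers (lem : ExcludedMiddle 0ℓ) {n m} (W : Fin m → Vec V3 n) (b : Vec V3 n)
                   (compatible : ∀ i k → lookup b k ≡ vN ⊎ lookup b k ≡ lookup (W i) k) where

  σ : Fin n → Sentence
  σ k = ⟦ Selector (lookup b k) (λ i → lookup (W i) k) ⟧ᶜ

  outcome : FIX → Vec V3 n
  outcome u = maybe′ W b (scan (τ-value u) m)

  σ-HasValue : ∀ u k → HasValue u (σ k) (lookup (outcome u) k)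
  σ-HasValue u k =
    subst (HasValue u (σ k)) value-σ (Compound-HasValue lem u (Selector (lookup b k) (λ i → lookup (W i) k)))
    where
    lookup-outcome : ∀ x → maybe′ (λ i → lookup (W i) k) (lookup b k) x ≡ lookup (maybe′ W b x) k
    lookup-outcome (just i) = refl
    lookup-outcome nothing  = refl
    value-σ : evalᶜ (τ-value u) (Selector (lookup b k) (λ i → lookup (W i) k)) ≡ lookup (outcome u) k
    value-σ = trans (Selector-value (lookup b k) _ (λ i → compatible i k) (τ-value u))
                    (lookup-outcome (scan (τ-value u) m))

  outcome-attains : ∀ i → Σ[ u ∈ FIX ] outcome u ≡ W i
  outcome-attains i = u , cong (maybe′ W b) (scan-firstTrueAt (τ-value u) i u-values)
    where
    prescribed : Σ[ u ∈ FIX ] (∀ j → τ-value u j ≡ firstTrueAt i j)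
    prescribed = prescribed-fixed-point lem (firstTrueAt i)
    u : FIX
    u = proj₁ prescribed
    u-values : ∀ j → τ-value u j ≡ firstTrueAt i j
    u-values = proj₂ prescribed

-- Derivations

module Derivations (n : ℕ) where

  infix 4 ⊢_ _⊢ᴸ_

  ⊢_ : MF → Set
  ⊢ A = S5CGM n A

  taut : ∀ {A} → (∀ v → v ⊨ A) → ⊢ A
  taut {A} ⊨A = ax-taut (λ v → from (evalB⇔⊨ v A) (⊨A v))

  ⊢-⇒ : ∀ {A B} → (∀ v → v ⊨ A → v ⊨ B) → ⊢ A ⇒' B
  ⊢-⇒ {A} {B} A⊨B = taut {A ⇒' B} (λ v (a , ¬b) → ¬b (A⊨B v a))

  by-taut : ∀ {A B} → (∀ v → v ⊨ A → v ⊨ B) → ⊢ A → ⊢ B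
  by-taut A⊨B = mp (⊢-⇒ A⊨B)

  ⊢-∧ : ∀ {A B} → ⊢ A → ⊢ B → ⊢ A ∧' B
  ⊢-∧ {A} {B} ⊢A ⊢B = mp (mp (taut {A ⇒' (B ⇒' (A ∧' B))} pairing) ⊢A) ⊢B
    where
    pairing : ∀ v → v ⊨ A ⇒' (B ⇒' (A ∧' B))
    pairing v (a , ¬[b⇒ab]) = ¬[b⇒ab] (λ (b , ¬ab) → ¬ab (a , b))

  by-taut₂ : ∀ {A B C} → (∀ v → v ⊨ A → v ⊨ B → v ⊨ C) → ⊢ A → ⊢ B → ⊢ C
  by-taut₂ h ⊢A ⊢B = by-taut (λ v (a , b) → h v a b) (⊢-∧ ⊢A ⊢B)

  ⇒-trans : ∀ {A B C} → ⊢ A ⇒' B → ⊢ B ⇒' C → ⊢ A ⇒' C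
  ⇒-trans {A} {B} {C} = by-taut₂ (λ v f g → from (⊨-⇒ v A C) (to (⊨-⇒ v B C) g ∘ to (⊨-⇒ v A B) f))

  contrapose : ∀ {A B} → ⊢ A ⇒' B → ⊢ ¬' B ⇒' ¬' A
  contrapose {A} {B} = by-taut (λ v f → from (⊨-⇒ v (¬' B) (¬' A)) (λ ¬b a → ¬b (to (⊨-⇒ v A B) f a)))

  ¬¬-elim : ∀ B → ⊢ ¬' (¬' B) ⇒' B
  ¬¬-elim B = ⊢-⇒ (λ v → ⊨-stable v B)

  ¬¬-intro : ∀ B → ⊢ B ⇒' ¬' (¬' B)
  ¬¬-intro B = ⊢-⇒ (λ v b ¬b → ¬b b)

  □-mono : ∀ {A B} → ⊢ A ⇒' B → ⊢ □ A ⇒' □ B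
  □-mono {A} {B} ⊢A⇒B = mp (ax-K A B) (nec ⊢A⇒B)

  □-∧ : ∀ A B → ⊢ (□ A ∧' □ B) ⇒' □ (A ∧' B)
  □-∧ A B = by-taut₂ chain (□-mono (⊢-⇒ (λ v a → from (⊨-⇒ v B (A ∧' B)) (λ b → a , b)))) (ax-K B (A ∧' B))
    where
    chain : ∀ v → v ⊨ □ A ⇒' □ (B ⇒' (A ∧' B)) → v ⊨ □ (B ⇒' (A ∧' B)) ⇒' (□ B ⇒' □ (A ∧' B)) →
            v ⊨ (□ A ∧' □ B) ⇒' □ (A ∧' B)
    chain v f g = from (⊨-⇒ v (□ A ∧' □ B) (□ (A ∧' B))) (λ (a , b) →
      to (⊨-⇒ v (□ B) (□ (A ∧' B))) (to (⊨-⇒ v (□ (B ⇒' (A ∧' B))) (□ B ⇒' □ (A ∧' B))) g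
        (to (⊨-⇒ v (□ A) (□ (B ⇒' (A ∧' B)))) f a)) b)

  ¬□⇒□¬□ : ∀ B → ⊢ ¬' (□ B) ⇒' □ (¬' (□ B))
  ¬□⇒□¬□ B = ⇒-trans (contrapose (□-mono (¬¬-elim B)))
               (⇒-trans (ax-5 (¬' B)) (□-mono (contrapose (□-mono (¬¬-intro B)))))

  □⇒□□ : ∀ B → ⊢ □ B ⇒' □ (□ B)
  □⇒□□ B = ⇒-trans □⇒◇□ (⇒-trans (ax-5 (□ B)) (□-mono ◇□⇒□))
    where
    □⇒◇□ : ⊢ □ B ⇒' ◇ (□ B)
    □⇒◇□ = ⇒-trans (¬¬-intro (□ B)) (contrapose (ax-T (¬' (□ B))))
    ◇□⇒□ : ⊢ ◇ (□ B) ⇒' □ B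
    ◇□⇒□ = ⇒-trans (contrapose (¬□⇒□¬□ B)) (¬¬-elim (□ B))

  ⋀ᴸ : List MF → MF
  ⋀ᴸ []      = ⊤'
  ⋀ᴸ (A ∷ Δ) = A ∧' ⋀ᴸ Δ

  ⊨-⋀ᴸ : ∀ v Δ → v ⊨ ⋀ᴸ Δ ⇔ (∀ {A} → A ∈ Δ → v ⊨ A)
  ⊨-⋀ᴸ v []      = mk⇔ (λ _ ()) (λ _ → ⊨-⊤' v)
  ⊨-⋀ᴸ v (A ∷ Δ) = mk⇔
    (λ (a , as) → λ { (here refl) → a ; (there A∈Δ) → to (⊨-⋀ᴸ v Δ) as A∈Δ })
    (λ h → h (here refl) , from (⊨-⋀ᴸ v Δ) (λ A∈Δ → h (there A∈Δ)))

  _⊢ᴸ_ : List MF → MF → Set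
  Δ ⊢ᴸ A = ⊢ ⋀ᴸ Δ ⇒' A

  ⊢ᴸ-by-taut : ∀ {Δ A B} → (∀ v → v ⊨ A → v ⊨ B) → Δ ⊢ᴸ A → Δ ⊢ᴸ B
  ⊢ᴸ-by-taut A⊨B Δ⊢A = ⇒-trans Δ⊢A (⊢-⇒ A⊨B)

  ⊢ᴸ-by-taut₂ : ∀ {Δ A B C} → (∀ v → v ⊨ A → v ⊨ B → v ⊨ C) → Δ ⊢ᴸ A → Δ ⊢ᴸ B → Δ ⊢ᴸ C
  ⊢ᴸ-by-taut₂ {Δ} {A} {B} {C} h = by-taut₂ (λ v f g → from (⊨-⇒ v (⋀ᴸ Δ) C) (λ δ →
    h v (to (⊨-⇒ v (⋀ᴸ Δ) A) f δ) (to (⊨-⇒ v (⋀ᴸ Δ) B) g δ)))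

  ⊢ᴸ-mp : ∀ {Δ A B} → Δ ⊢ᴸ A ⇒' B → Δ ⊢ᴸ A → Δ ⊢ᴸ B
  ⊢ᴸ-mp {A = A} {B} = ⊢ᴸ-by-taut₂ (λ v → to (⊨-⇒ v A B))

  ⊢ᴸ-∧ : ∀ {Δ A B} → Δ ⊢ᴸ A → Δ ⊢ᴸ B → Δ ⊢ᴸ A ∧' B
  ⊢ᴸ-∧ = ⊢ᴸ-by-taut₂ (λ v a b → a , b)

  ⊢ᴸ-∧₁ : ∀ {Δ A B} → Δ ⊢ᴸ A ∧' B → Δ ⊢ᴸ A
  ⊢ᴸ-∧₁ = ⊢ᴸ-by-taut (λ v → proj₁)

  ⊢ᴸ-∧₂ : ∀ {Δ A B} → Δ ⊢ᴸ A ∧' B → Δ ⊢ᴸ B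
  ⊢ᴸ-∧₂ = ⊢ᴸ-by-taut (λ v → proj₂)

  ⊢ᴸ-¬¬ : ∀ {Δ A} → Δ ⊢ᴸ ¬' (¬' A) → Δ ⊢ᴸ A
  ⊢ᴸ-¬¬ {A = A} Δ⊢¬¬A = ⇒-trans Δ⊢¬¬A (¬¬-elim A)

  ∈⇒⊢ᴸ : ∀ {Δ A} → A ∈ Δ → Δ ⊢ᴸ A
  ∈⇒⊢ᴸ {Δ} A∈Δ = ⊢-⇒ (λ v δ → to (⊨-⋀ᴸ v Δ) δ A∈Δ)

  ⊢⇒⊢ᴸ : ∀ {Δ A} → ⊢ A → Δ ⊢ᴸ A
  ⊢⇒⊢ᴸ = by-taut (λ v a (_ , ¬a) → ¬a a)

  ⊢ᴸ-⋀ᴸ : ∀ {Δ} L → (∀ {A} → A ∈ L → Δ ⊢ᴸ A) → Δ ⊢ᴸ ⋀ᴸ L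
  ⊢ᴸ-⋀ᴸ []      _  = ⊢⇒⊢ᴸ (taut ⊨-⊤')
  ⊢ᴸ-⋀ᴸ (A ∷ L) ⊢L = ⊢ᴸ-∧ (⊢L (here refl)) (⊢ᴸ-⋀ᴸ L (λ A∈L → ⊢L (there A∈L)))

  ⋀ᴸ-stable : ∀ L → (∀ {A} → A ∈ L → ⊢ A ⇒' □ A) → ⊢ ⋀ᴸ L ⇒' □ (⋀ᴸ L)
  ⋀ᴸ-stable []      _      = by-taut (λ v □⊤ (_ , ¬□⊤) → ¬□⊤ □⊤) (nec (taut ⊨-⊤'))
  ⋀ᴸ-stable (A ∷ L) stable =
    by-taut₂ both (⊢-∧ (stable (here refl)) (⋀ᴸ-stable L (λ A∈L → stable (there A∈L)))) (□-∧ A (⋀ᴸ L))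
    where
    both : ∀ v → v ⊨ (A ⇒' □ A) ∧' (⋀ᴸ L ⇒' □ (⋀ᴸ L)) → v ⊨ (□ A ∧' □ (⋀ᴸ L)) ⇒' □ (A ∧' ⋀ᴸ L) →
           v ⊨ (A ∧' ⋀ᴸ L) ⇒' □ (A ∧' ⋀ᴸ L)
    both v (sa , sL) f = from (⊨-⇒ v (A ∧' ⋀ᴸ L) (□ (A ∧' ⋀ᴸ L))) (λ (a , l) →
      to (⊨-⇒ v (□ A ∧' □ (⋀ᴸ L)) (□ (A ∧' ⋀ᴸ L))) f
        (to (⊨-⇒ v A (□ A)) sa a , to (⊨-⇒ v (⋀ᴸ L) (□ (⋀ᴸ L))) sL l))

  Consistent : List MF → Set
  Consistent Δ = ¬ (⊢ ¬' (⋀ᴸ Δ))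

  Consistent-⊢ᴸ : ∀ {Δ A} → Consistent Δ → Δ ⊢ᴸ A → Δ ⊢ᴸ ¬' A → ⊥
  Consistent-⊢ᴸ {Δ} {A} consistent ⊢A ⊢¬A = consistent (by-taut₂ (λ v f g δ →
    to (⊨-⇒ v (⋀ᴸ Δ) (¬' A)) g δ (to (⊨-⇒ v (⋀ᴸ Δ) A) f δ)) ⊢A ⊢¬A)

-- Worlds: consistent sets deciding finitely many formulas

module Canonical (n : ℕ) (lem : ExcludedMiddle 0ℓ) (Rel : List MF) where
  open Derivations n public

  Consistent-∷ : ∀ {Δ} A → Consistent Δ → Consistent (A ∷ Δ) ⊎ Consistent (¬' A ∷ Δ)
  Consistent-∷ {Δ} A consistent with lem {Consistent (A ∷ Δ)} | lem {Consistent (¬' A ∷ Δ)}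
  ... | yes c  | _      = inj₁ c
  ... | no _   | yes c′ = inj₂ c′
  ... | no ¬c  | no ¬c′ = ⊥-elim (consistent (by-taut₂ split (em⇒dne lem ¬c) (em⇒dne lem ¬c′)))
    where
    split : ∀ v → v ⊨ ¬' (A ∧' ⋀ᴸ Δ) → v ⊨ ¬' (¬' A ∧' ⋀ᴸ Δ) → v ⊨ ¬' (⋀ᴸ Δ)
    split v f g δ with ⊨-dec v A
    ... | yes a = f (a , δ)
    ... | no ¬a = g (¬a , δ)

  decide : (R : List MF) → ∀ {Δ} → Consistent Δ →
           Σ[ Δ′ ∈ List MF ] Consistent Δ′ × Δ ⊆ Δ′ × (∀ {A} → A ∈ R → A ∈ Δ′ ⊎ ¬' A ∈ Δ′)
  decide []      c = _ , c , (λ A∈Δ → A∈Δ) , λ ()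
  decide (A ∷ R) c with Consistent-∷ A c
  ... | inj₁ c₁ with Δ′ , c′ , ⊆Δ′ , decided ← decide R c₁ =
    Δ′ , c′ , (λ B∈ → ⊆Δ′ (there B∈)) , λ { (here refl) → inj₁ (⊆Δ′ (here refl)) ; (there A∈R) → decided A∈R }
  ... | inj₂ c₂ with Δ′ , c′ , ⊆Δ′ , decided ← decide R c₂ =
    Δ′ , c′ , (λ B∈ → ⊆Δ′ (there B∈)) , λ { (here refl) → inj₂ (⊆Δ′ (here refl)) ; (there A∈R) → decided A∈R }

  record World : Set where
    field
      formulas   : List MF
      consistent : Consistent formulas
      decides    : ∀ {A} → A ∈ Rel → formulas ⊢ᴸ A ⊎ formulas ⊢ᴸ ¬' A
  open World public

  infix 4 _⊩ʷ_

  _⊩ʷ_ : World → MF → Set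
  Δ ⊩ʷ A = formulas Δ ⊢ᴸ A

  extend : ∀ Δ → Consistent Δ → Σ[ w ∈ World ] Δ ⊆ formulas w
  extend Δ c with Δ′ , c′ , ⊆Δ′ , decided ← decide Rel c = record
    { formulas = Δ′ ; consistent = c′
    ; decides = λ A∈Rel → Sum.map ∈⇒⊢ᴸ ∈⇒⊢ᴸ (decided A∈Rel) } , ⊆Δ′

  ⊩ʷ-consistent : ∀ Δ {A} → Δ ⊩ʷ A → Δ ⊩ʷ ¬' A → ⊥
  ⊩ʷ-consistent Δ = Consistent-⊢ᴸ (consistent Δ)

  ⊩ʷ-¬ : ∀ Δ {A} → A ∈ Rel → ¬ (Δ ⊩ʷ A) → Δ ⊩ʷ ¬' A
  ⊩ʷ-¬ Δ A∈Rel ⊮A with decides Δ A∈Rel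
  ... | inj₁ ⊩A  = contradiction ⊩A ⊮A
  ... | inj₂ ⊩¬A = ⊩¬A

  ⊩ʷ-⋀⁺ : ∀ Δ (f : ℕ → MF) {k} (ys : Vec ℕ k) → (∀ i → Δ ⊩ʷ f (lookup ys i)) → Δ ⊩ʷ ⋀ (mapV f ys)
  ⊩ʷ-⋀⁺ Δ f []           _ = ⊢⇒⊢ᴸ (taut ⊨-⊤')
  ⊩ʷ-⋀⁺ Δ f (y ∷ [])     h = h fzero
  ⊩ʷ-⋀⁺ Δ f (y ∷ z ∷ ys) h = ⊢ᴸ-∧ (h fzero) (⊩ʷ-⋀⁺ Δ f (z ∷ ys) (h ∘ fsuc))

  ⊩ʷ-⋀⁻ : ∀ Δ (f : ℕ → MF) {k} (ys : Vec ℕ k) → Δ ⊩ʷ ⋀ (mapV f ys) → ∀ i → Δ ⊩ʷ f (lookup ys i)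
  ⊩ʷ-⋀⁻ Δ f (y ∷ [])     ⊩⋀ fzero    = ⊩⋀
  ⊩ʷ-⋀⁻ Δ f (y ∷ z ∷ ys) ⊩⋀ fzero    = ⊢ᴸ-∧₁ ⊩⋀
  ⊩ʷ-⋀⁻ Δ f (y ∷ z ∷ ys) ⊩⋀ (fsuc i) = ⊩ʷ-⋀⁻ Δ f (z ∷ ys) (⊢ᴸ-∧₂ ⊩⋀) i

  SameBoxes : World → World → Set
  SameBoxes Δ Γ = ∀ {B} → □ B ∈ Rel → Δ ⊩ʷ □ B ⇔ Γ ⊩ʷ □ B

  SameBoxes-refl : ∀ Γ → SameBoxes Γ Γ
  SameBoxes-refl Γ _ = mk⇔ (λ x → x) (λ x → x)

  boxes : List MF → List MF
  boxes []          = []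
  boxes (T _ ∷ R)   = boxes R
  boxes (F _ ∷ R)   = boxes R
  boxes (¬' _ ∷ R)  = boxes R
  boxes (_ ∧' _ ∷ R) = boxes R
  boxes (□ B ∷ R)   = B ∷ boxes R

  □∈⇒∈boxes : ∀ {B} R → □ B ∈ R → B ∈ boxes R
  □∈⇒∈boxes (□ B ∷ R)    (here refl) = here refl
  □∈⇒∈boxes (T _ ∷ R)    (there □B∈R) = □∈⇒∈boxes R □B∈R
  □∈⇒∈boxes (F _ ∷ R)    (there □B∈R) = □∈⇒∈boxes R □B∈R
  □∈⇒∈boxes (¬' _ ∷ R)   (there □B∈R) = □∈⇒∈boxes R □B∈R
  □∈⇒∈boxes (_ ∧' _ ∷ R) (there □B∈R) = □∈⇒∈boxes R □B∈R
  □∈⇒∈boxes (□ _ ∷ R)    (there □B∈R) = there (□∈⇒∈boxes R □B∈R)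

  ∈boxes⇒□∈ : ∀ {B} R → B ∈ boxes R → □ B ∈ R
  ∈boxes⇒□∈ (T _ ∷ R)    B∈ = there (∈boxes⇒□∈ R B∈)
  ∈boxes⇒□∈ (F _ ∷ R)    B∈ = there (∈boxes⇒□∈ R B∈)
  ∈boxes⇒□∈ (¬' _ ∷ R)   B∈ = there (∈boxes⇒□∈ R B∈)
  ∈boxes⇒□∈ (_ ∧' _ ∷ R) B∈ = there (∈boxes⇒□∈ R B∈)
  ∈boxes⇒□∈ (□ _ ∷ R)    (here refl) = here refl
  ∈boxes⇒□∈ (□ _ ∷ R)    (there B∈) = there (∈boxes⇒□∈ R B∈)

  literal : ∀ {P : Set} → Dec P → MF → MF
  literal (yes _) B = □ B
  literal (no _)  B = ¬' (□ B)

  literal-stable : ∀ {P : Set} (d : Dec P) B → ⊢ literal d B ⇒' □ (literal d B)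
  literal-stable (yes _) B = □⇒□□ B
  literal-stable (no _)  B = ¬□⇒□¬□ B

  modalTheory : World → List MF
  modalTheory Γ = map (λ B → literal (lem {Γ ⊩ʷ □ B}) B) (boxes Rel)

  modalTheory-stable : ∀ Γ → ⊢ ⋀ᴸ (modalTheory Γ) ⇒' □ (⋀ᴸ (modalTheory Γ))
  modalTheory-stable Γ = ⋀ᴸ-stable (modalTheory Γ) stable
    where
    stable : ∀ {A} → A ∈ modalTheory Γ → ⊢ A ⇒' □ A
    stable A∈ with B , _ , refl ← ∈-map⁻ _ A∈ = literal-stable (lem {Γ ⊩ʷ □ B}) B

  literal-∈ : ∀ Γ {B} → □ B ∈ Rel → literal (lem {Γ ⊩ʷ □ B}) B ∈ modalTheory Γ
  literal-∈ Γ □B∈Rel = ∈-map⁺ (λ B → literal (lem {Γ ⊩ʷ □ B}) B) (□∈⇒∈boxes Rel □B∈Rel)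

  ⊩-literal : ∀ Γ {B} → □ B ∈ Rel → (d : Dec (Γ ⊩ʷ □ B)) → Γ ⊩ʷ literal d B
  ⊩-literal Γ □B∈Rel (yes ⊩□B) = ⊩□B
  ⊩-literal Γ □B∈Rel (no ⊮□B)  = ⊩ʷ-¬ Γ □B∈Rel ⊮□B

  ⊩-modalTheory : ∀ Γ → Γ ⊩ʷ ⋀ᴸ (modalTheory Γ)
  ⊩-modalTheory Γ = ⊢ᴸ-⋀ᴸ (modalTheory Γ) holds
    where
    holds : ∀ {A} → A ∈ modalTheory Γ → Γ ⊩ʷ A
    holds A∈ with B , B∈ , refl ← ∈-map⁻ _ A∈ = ⊩-literal Γ (∈boxes⇒□∈ Rel B∈) (lem {Γ ⊩ʷ □ B})

  -- Γ's modal theory is necessary, so if it were inconsistent with ¬ A then Γ would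
  -- prove □ A.
  existence : ∀ Γ {A} → Γ ⊩ʷ ¬' (□ A) → Σ[ Δ ∈ World ] Δ ⊩ʷ ¬' A × SameBoxes Δ Γ
  existence Γ {A} ⊩¬□A = Δ , ∈⇒⊢ᴸ (base⊆Δ (here refl)) , same-boxes
    where
    Θ : MF
    Θ = ⋀ᴸ (modalTheory Γ)
    base-consistent : Consistent (¬' A ∷ modalTheory Γ)
    base-consistent ⊢¬[¬A∧Θ] = ⊩ʷ-consistent Γ (⊢ᴸ-mp (⊢⇒⊢ᴸ (⇒-trans (modalTheory-stable Γ) (□-mono Θ⇒A)))
                                                       (⊩-modalTheory Γ)) ⊩¬□A
      where
      Θ⇒A : ⊢ Θ ⇒' A
      Θ⇒A = by-taut (λ v ¬[¬a∧θ] (θ , ¬a) → ¬[¬a∧θ] (¬a , θ)) ⊢¬[¬A∧Θ]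
    extended : Σ[ Δ ∈ World ] (¬' A ∷ modalTheory Γ) ⊆ formulas Δ
    extended = extend (¬' A ∷ modalTheory Γ) base-consistent
    Δ : World
    Δ = proj₁ extended
    base⊆Δ : (¬' A ∷ modalTheory Γ) ⊆ formulas Δ
    base⊆Δ = proj₂ extended
    same-boxes : SameBoxes Δ Γ
    same-boxes {B} □B∈Rel with lem {Γ ⊩ʷ □ B} | literal-∈ Γ □B∈Rel
    ... | yes ⊩□B | lit∈ = mk⇔ (λ _ → ⊩□B) (λ _ → ∈⇒⊢ᴸ (base⊆Δ (there lit∈)))
    ... | no ⊮□B  | lit∈ = mk⇔ (λ ⊩□B → ⊥-elim (⊩ʷ-consistent Δ ⊩□B (∈⇒⊢ᴸ (base⊆Δ (there lit∈)))))
                               (λ ⊩□B → contradiction ⊩□B ⊮□B)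

  □-elim : ∀ {Δ Γ B} → □ B ∈ Rel → SameBoxes Δ Γ → Γ ⊩ʷ □ B → Δ ⊩ʷ B
  □-elim {B = B} □B∈Rel same ⊩□B = ⊢ᴸ-mp (⊢⇒⊢ᴸ (ax-T B)) (from (same □B∈Rel) ⊩□B)

  □-intro : ∀ Γ {B} → □ B ∈ Rel → (∀ Δ → SameBoxes Δ Γ → Δ ⊩ʷ B) → Γ ⊩ʷ □ B
  □-intro Γ {B} □B∈Rel everywhere with decides Γ □B∈Rel
  ... | inj₁ ⊩□B  = ⊩□B
  ... | inj₂ ⊩¬□B with Δ , ⊩¬B , same ← existence Γ ⊩¬□B = ⊥-elim (⊩ʷ-consistent Δ (everywhere Δ same) ⊩¬B)

  ◇-intro : ∀ {Δ Γ A} → □ (¬' A) ∈ Rel → SameBoxes Δ Γ → Δ ⊩ʷ A → Γ ⊩ʷ ◇ A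
  ◇-intro {Δ} {Γ} □¬A∈Rel same ⊩A with decides Γ □¬A∈Rel
  ... | inj₁ ⊩□¬A = ⊥-elim (⊩ʷ-consistent Δ ⊩A (□-elim {Δ} {Γ} □¬A∈Rel same ⊩□¬A))
  ... | inj₂ ⊩◇A  = ⊩◇A

-- Completeness

infix 4 _⊑_

data _⊑_ : MF → MF → Set where
  ⊑-refl : ∀ {A} → A ⊑ A
  ⊑-¬    : ∀ {A B} → A ⊑ B → A ⊑ ¬' B
  ⊑-∧ˡ   : ∀ {A B C} → A ⊑ B → A ⊑ (B ∧' C)
  ⊑-∧ʳ   : ∀ {A B C} → A ⊑ C → A ⊑ (B ∧' C)
  ⊑-□    : ∀ {A B} → A ⊑ B → A ⊑ □ B

⊑-trans : ∀ {A B C} → A ⊑ B → B ⊑ C → A ⊑ C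
⊑-trans A⊑B ⊑-refl     = A⊑B
⊑-trans A⊑B (⊑-¬ B⊑C)  = ⊑-¬ (⊑-trans A⊑B B⊑C)
⊑-trans A⊑B (⊑-∧ˡ B⊑C) = ⊑-∧ˡ (⊑-trans A⊑B B⊑C)
⊑-trans A⊑B (⊑-∧ʳ B⊑C) = ⊑-∧ʳ (⊑-trans A⊑B B⊑C)
⊑-trans A⊑B (⊑-□ B⊑C)  = ⊑-□ (⊑-trans A⊑B B⊑C)

⊑-¬⁻ : ∀ {A φ} → ¬' A ⊑ φ → A ⊑ φ
⊑-¬⁻ = ⊑-trans (⊑-¬ ⊑-refl)

⊑-∧ˡ⁻ : ∀ {A B φ} → A ∧' B ⊑ φ → A ⊑ φ
⊑-∧ˡ⁻ = ⊑-trans (⊑-∧ˡ ⊑-refl)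

⊑-∧ʳ⁻ : ∀ {A B φ} → A ∧' B ⊑ φ → B ⊑ φ
⊑-∧ʳ⁻ = ⊑-trans (⊑-∧ʳ ⊑-refl)

⊑-□⁻ : ∀ {A φ} → □ A ⊑ φ → A ⊑ φ
⊑-□⁻ = ⊑-trans (⊑-□ ⊑-refl)

subformulas : MF → List MF
subformulas (T x)    = T x ∷ []
subformulas (F x)    = F x ∷ []
subformulas (¬' A)   = ¬' A ∷ subformulas A
subformulas (A ∧' B) = (A ∧' B) ∷ (subformulas A ++ subformulas B)
subformulas (□ A)    = □ A ∷ subformulas A

⊑⇒∈subformulas : ∀ {A φ} → A ⊑ φ → A ∈ subformulas φ
⊑⇒∈subformulas {φ = T x}    ⊑-refl = here refl
⊑⇒∈subformulas {φ = F x}    ⊑-refl = here refl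
⊑⇒∈subformulas {φ = ¬' φ}   ⊑-refl = here refl
⊑⇒∈subformulas {φ = φ ∧' ψ} ⊑-refl = here refl
⊑⇒∈subformulas {φ = □ φ}    ⊑-refl = here refl
⊑⇒∈subformulas (⊑-¬ A⊑φ)  = there (⊑⇒∈subformulas A⊑φ)
⊑⇒∈subformulas (⊑-∧ˡ A⊑φ) = there (∈-++⁺ˡ (⊑⇒∈subformulas A⊑φ))
⊑⇒∈subformulas {φ = φ ∧' ψ} (⊑-∧ʳ A⊑ψ) = there (∈-++⁺ʳ (subformulas φ) (⊑⇒∈subformulas A⊑ψ))
⊑⇒∈subformulas (⊑-□ A⊑φ)  = there (⊑⇒∈subformulas A⊑φ)

⊑-Occurs : ∀ {A φ x} → A ⊑ φ → Occurs x A → Occurs x φ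
⊑-Occurs ⊑-refl     o = o
⊑-Occurs (⊑-¬ p)    o = o¬ (⊑-Occurs p o)
⊑-Occurs (⊑-∧ˡ p)   o = o∧ˡ (⊑-Occurs p o)
⊑-Occurs (⊑-∧ʳ p)   o = o∧ʳ (⊑-Occurs p o)
⊑-Occurs (⊑-□ p)    o = o□ (⊑-Occurs p o)

atomFormulas : ℕ → List MF
atomFormulas x = T x ∷ F x ∷ □ (¬' (T x)) ∷ □ (¬' (F x)) ∷ □ (¬' (N x)) ∷ []

variableFormulas : ∀ {n} → Vec ℕ n → List MF
variableFormulas []       = []
variableFormulas (x ∷ xs) = atomFormulas x ++ variableFormulas xs

atomFormulas⊆ : ∀ {n} (xs : Vec ℕ n) k → atomFormulas (lookup xs k) ⊆ variableFormulas xs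
atomFormulas⊆ (x ∷ xs) fzero    = ∈-++⁺ˡ
atomFormulas⊆ (x ∷ xs) (fsuc k) = ∈-++⁺ʳ (atomFormulas x) ∘ atomFormulas⊆ xs k

allVectors : ∀ n → List (Vec V3 n)
allVectors zero    = [] ∷ []
allVectors (suc n) = map (vT ∷_) (allVectors n) ++ map (vF ∷_) (allVectors n) ++ map (vN ∷_) (allVectors n)

∈-allVectors : ∀ {n} (v : Vec V3 n) → v ∈ allVectors n
∈-allVectors [] = here refl
∈-allVectors {suc n} (vT ∷ v) = ∈-++⁺ˡ (∈-map⁺ (vT ∷_) (∈-allVectors v))
∈-allVectors {suc n} (vF ∷ v) = ∈-++⁺ʳ (map (vT ∷_) (allVectors n)) (∈-++⁺ˡ (∈-map⁺ (vF ∷_) (∈-allVectors v)))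
∈-allVectors {suc n} (vN ∷ v) =
  ∈-++⁺ʳ (map (vT ∷_) (allVectors n)) (∈-++⁺ʳ (map (vF ∷_) (allVectors n)) (∈-map⁺ (vN ∷_) (∈-allVectors v)))

-- Junk value: the last position when x does not occur.
indexOf : ∀ {n} → Vec ℕ (suc n) → ℕ → Fin (suc n)
indexOf (y ∷ [])     x = fzero
indexOf (y ∷ z ∷ ys) x with y ≟ x
... | yes _ = fzero
... | no _  = fsuc (indexOf (z ∷ ys) x)

lookup-indexOf : ∀ {n} (xs : Vec ℕ (suc n)) {x} → x ∈V xs → lookup xs (indexOf xs x) ≡ x
lookup-indexOf (y ∷ [])     here       = refl
lookup-indexOf (y ∷ z ∷ ys) {x} x∈ with y ≟ x | x∈
... | yes y≡x | _        = y≡x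
... | no y≢x  | here     = contradiction refl y≢x
... | no _    | there x∈′ = lookup-indexOf (z ∷ ys) x∈′

valueOf : ∀ {P Q : Set} → Dec P → Dec Q → V3
valueOf (yes _) _       = vT
valueOf (no _)  (yes _) = vF
valueOf (no _)  (no _)  = vN

valueOf-T : ∀ {P Q : Set} (p : Dec P) (q : Dec Q) → valueOf p q ≡ vT ⇔ P
valueOf-T (yes p) _       = mk⇔ (λ _ → p) (λ _ → refl)
valueOf-T (no ¬p) (yes _) = mk⇔ (λ ()) (λ p → contradiction p ¬p)
valueOf-T (no ¬p) (no _)  = mk⇔ (λ ()) (λ p → contradiction p ¬p)

valueOf-F : ∀ {P Q : Set} (p : Dec P) (q : Dec Q) → ¬ (P × Q) → valueOf p q ≡ vF ⇔ Q
valueOf-F (yes p) (yes q) ¬p×q = contradiction (p , q) ¬p×q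
valueOf-F (yes p) (no ¬q) _    = mk⇔ (λ ()) (λ q → contradiction q ¬q)
valueOf-F (no _)  (yes q) _    = mk⇔ (λ _ → q) (λ _ → refl)
valueOf-F (no _)  (no ¬q) _    = mk⇔ (λ ()) (λ q → contradiction q ¬q)

valueOf-N : ∀ {P Q : Set} (p : Dec P) (q : Dec Q) → valueOf p q ≡ vN ⇔ (¬ P × ¬ Q)
valueOf-N (yes p) _       = mk⇔ (λ ()) (λ (¬p , _) → contradiction p ¬p)
valueOf-N (no _)  (yes q) = mk⇔ (λ ()) (λ (_ , ¬q) → contradiction q ¬q)
valueOf-N (no ¬p) (no ¬q) = mk⇔ (λ _ → ¬p , ¬q) (λ _ → refl)

module Completeness (lem : ExcludedMiddle 0ℓ) {n} (φ : MF) (xs : Vec ℕ (suc n))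
                    (vars : ∀ x → Occurs x φ → x ∈V xs) (⊬φ : ¬ S5CGM (suc n) φ) where

  Rel : List MF
  Rel = subformulas φ ++ variableFormulas xs

  open Canonical (suc n) lem Rel

  ⊑φ⇒∈Rel : ∀ {A} → A ⊑ φ → A ∈ Rel
  ⊑φ⇒∈Rel = ∈-++⁺ˡ ∘ ⊑⇒∈subformulas

  atom∈Rel : ∀ k {A} → A ∈ atomFormulas (lookup xs k) → A ∈ Rel
  atom∈Rel k = ∈-++⁺ʳ (subformulas φ) ∘ atomFormulas⊆ xs k

  T∈Rel : ∀ k → T (lookup xs k) ∈ Rel
  T∈Rel k = atom∈Rel k (here refl)

  F∈Rel : ∀ k → F (lookup xs k) ∈ Rel
  F∈Rel k = atom∈Rel k (there (here refl))

  □¬T∈Rel : ∀ k → □ (¬' (T (lookup xs k))) ∈ Rel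
  □¬T∈Rel k = atom∈Rel k (there (there (here refl)))

  □¬F∈Rel : ∀ k → □ (¬' (F (lookup xs k))) ∈ Rel
  □¬F∈Rel k = atom∈Rel k (there (there (there (here refl))))

  □¬N∈Rel : ∀ k → □ (¬' (N (lookup xs k))) ∈ Rel
  □¬N∈Rel k = atom∈Rel k (there (there (there (there (here refl)))))

  Γ-extended : Σ[ Γ ∈ World ] (¬' φ ∷ []) ⊆ formulas Γ
  Γ-extended = extend (¬' φ ∷ []) (λ ⊢¬[¬φ∧⊤] →
    ⊬φ (by-taut (λ v ¬[¬φ∧⊤] → ⊨-stable v φ (λ ¬φ → ¬[¬φ∧⊤] (¬φ , ⊨-⊤' v))) ⊢¬[¬φ∧⊤]))

  Γ : World
  Γ = proj₁ Γ-extended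

  Γ⊩¬φ : Γ ⊩ʷ ¬' φ
  Γ⊩¬φ = ∈⇒⊢ᴸ (proj₂ Γ-extended (here refl))

  value : World → ℕ → V3
  value Δ x = valueOf (lem {Δ ⊩ʷ T x}) (lem {Δ ⊩ʷ F x})

  value-T : ∀ Δ x → value Δ x ≡ vT ⇔ Δ ⊩ʷ T x
  value-T Δ x = valueOf-T (lem {Δ ⊩ʷ T x}) _

  value-F : ∀ Δ x → value Δ x ≡ vF ⇔ Δ ⊩ʷ F x
  value-F Δ x = valueOf-F (lem {Δ ⊩ʷ T x}) _ (λ (⊩T , ⊩F) → ⊩ʷ-consistent Δ (⊢ᴸ-∧ ⊩T ⊩F) (⊢⇒⊢ᴸ (ax-Con x)))

  value-N : ∀ Δ k → value Δ (lookup xs k) ≡ vN ⇔ Δ ⊩ʷ N (lookup xs k)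
  value-N Δ k = neither ⇔-∘ valueOf-N (lem {Δ ⊩ʷ T (lookup xs k)}) _
    where
    neither : (¬ Δ ⊩ʷ T (lookup xs k) × ¬ Δ ⊩ʷ F (lookup xs k)) ⇔ Δ ⊩ʷ N (lookup xs k)
    neither = mk⇔ (λ (⊮T , ⊮F) → ⊢ᴸ-∧ (⊩ʷ-¬ Δ (T∈Rel k) ⊮T) (⊩ʷ-¬ Δ (F∈Rel k) ⊮F))
                  (λ ⊩N → (λ ⊩T → ⊩ʷ-consistent Δ ⊩T (⊢ᴸ-∧₁ ⊩N)) , (λ ⊩F → ⊩ʷ-consistent Δ ⊩F (⊢ᴸ-∧₂ ⊩N)))

  values : World → Vec V3 (suc n)
  values Δ = tabulate (value Δ ∘ lookup xs)

  lookup-values : ∀ Δ k → lookup (values Δ) k ≡ value Δ (lookup xs k)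
  lookup-values Δ k = lookup∘tabulate (value Δ ∘ lookup xs) k

  Cluster : World → Set
  Cluster Δ = SameBoxes Δ Γ

  PossiblyNeither : Fin (suc n) → Set
  PossiblyNeither k = Σ[ Δ ∈ World ] Cluster Δ × Δ ⊩ʷ N (lookup xs k)

  ◇-neither : ∀ k → PossiblyNeither k → Γ ⊩ʷ ◇ (N (lookup xs k))
  ◇-neither k (Δ , same , ⊩N) = ◇-intro {Δ} {Γ} (□¬N∈Rel k) same ⊩N

  ground : ∀ k {Δ₁ Δ₂} → Cluster Δ₁ → Cluster Δ₂ → Δ₁ ⊩ʷ T (lookup xs k) → Δ₂ ⊩ʷ F (lookup xs k) →
           PossiblyNeither k
  ground k {Δ₁} {Δ₂} c₁ c₂ ⊩T ⊩F = let (Δ , ⊩¬¬N , same) = existence Γ ◇N in Δ , same , ⊢ᴸ-¬¬ ⊩¬¬N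
    where
    ◇N : Γ ⊩ʷ ◇ (N (lookup xs k))
    ◇N = ⊢ᴸ-mp (⊢⇒⊢ᴸ (ax-Ground (lookup xs k)))
           (⊢ᴸ-∧ (◇-intro {Δ₁} {Γ} (□¬T∈Rel k) c₁ ⊩T) (◇-intro {Δ₂} {Γ} (□¬F∈Rel k) c₂ ⊩F))

  -- Min, applied to the variables that are possibly neither (padded with one of them),
  -- gives a world of the cluster where all of them are neither at once.
  bottom : Σ[ Δ ∈ World ] Cluster Δ × (∀ k → PossiblyNeither k → Δ ⊩ʷ N (lookup xs k))
  bottom with lem {Σ[ k ∈ Fin (suc n) ] PossiblyNeither k}
  ... | no none = Γ , SameBoxes-refl Γ , λ k p → contradiction (k , p) none
  ... | yes (k₀ , p₀) = Δ , same , all-neither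
    where
    pick : ∀ k → Dec (PossiblyNeither k) → ℕ
    pick k (yes _) = lookup xs k
    pick k (no _)  = lookup xs k₀
    choose : Fin (suc n) → ℕ
    choose k = pick k (lem {PossiblyNeither k})
    ys : Vec ℕ (suc n)
    ys = tabulate choose
    each : ∀ k (d : Dec (PossiblyNeither k)) → Γ ⊩ʷ ◇ (N (pick k d))
    each k (yes p) = ◇-neither k p
    each k (no _)  = ◇-neither k₀ p₀
    ◇⋀N : Γ ⊩ʷ ◇ (⋀ (mapV N ys))
    ◇⋀N = ⊢ᴸ-mp (⊢⇒⊢ᴸ (ax-Min ys)) (⊩ʷ-⋀⁺ Γ (λ x → ◇ (N x)) ys (λ k →
            subst (λ x → Γ ⊩ʷ ◇ (N x)) (sym (lookup∘tabulate choose k)) (each k (lem {PossiblyNeither k}))))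
    pick-yes : ∀ k → PossiblyNeither k → (d : Dec (PossiblyNeither k)) → pick k d ≡ lookup xs k
    pick-yes k p (yes _) = refl
    pick-yes k p (no ¬p) = contradiction p ¬p
    witness : Σ[ Δ ∈ World ] Δ ⊩ʷ ¬' (¬' (⋀ (mapV N ys))) × Cluster Δ
    witness = existence Γ ◇⋀N
    Δ : World
    Δ = proj₁ witness
    same : Cluster Δ
    same = proj₂ (proj₂ witness)
    all-neither : ∀ k → PossiblyNeither k → Δ ⊩ʷ N (lookup xs k)
    all-neither k p = subst (λ x → Δ ⊩ʷ N x)
      (trans (lookup∘tabulate choose k) (pick-yes k p (lem {PossiblyNeither k})))
      (⊩ʷ-⋀⁻ Δ N ys (⊢ᴸ-¬¬ (proj₁ (proj₂ witness))) k)

  Δ₀ : World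
  Δ₀ = proj₁ bottom

  Δ₀-cluster : Cluster Δ₀
  Δ₀-cluster = proj₁ (proj₂ bottom)

  Δ₀-neither : ∀ k → PossiblyNeither k → value Δ₀ (lookup xs k) ≡ vN
  Δ₀-neither k p = from (value-N Δ₀ k) (proj₂ (proj₂ bottom) k p)

  Δ₀-compatible : ∀ Δ → Cluster Δ → ∀ k s t → value Δ₀ (lookup xs k) ≡ s → value Δ (lookup xs k) ≡ t →
                  s ≡ vN ⊎ s ≡ t
  Δ₀-compatible Δ c k vN t  _  _ = inj₁ refl
  Δ₀-compatible Δ c k vT vT _  _ = inj₂ refl
  Δ₀-compatible Δ c k vF vF _  _ = inj₂ refl
  Δ₀-compatible Δ c k vT vF e₀ e = ⊥-elim (N≢T (trans (sym (Δ₀-neither k possibly-neither)) e₀))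
    where
    possibly-neither : PossiblyNeither k
    possibly-neither = ground k {Δ₀} {Δ} Δ₀-cluster c (to (value-T Δ₀ _) e₀) (to (value-F Δ _) e)
  Δ₀-compatible Δ c k vF vT e₀ e = ⊥-elim (N≢F (trans (sym (Δ₀-neither k possibly-neither)) e₀))
    where
    possibly-neither : PossiblyNeither k
    possibly-neither = ground k {Δ} {Δ₀} c Δ₀-cluster (to (value-T Δ _) e) (to (value-F Δ₀ _) e₀)
  Δ₀-compatible Δ c k vT vN e₀ e = ⊥-elim (N≢T (trans (sym (Δ₀-neither k (Δ , c , to (value-N Δ k) e))) e₀))
  Δ₀-compatible Δ c k vF vN e₀ e = ⊥-elim (N≢F (trans (sym (Δ₀-neither k (Δ , c , to (value-N Δ k) e))) e₀))

  Realized : Vec V3 (suc n) → Set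
  Realized v = Σ[ Δ ∈ World ] Cluster Δ × values Δ ≡ v

  realizable : List (Vec V3 (suc n))
  realizable = filter (λ v → lem {Realized v}) (allVectors (suc n))

  W : Fin (length realizable) → Vec V3 (suc n)
  W = List.lookup realizable

  W-realized : ∀ i → Realized (W i)
  W-realized i = proj₂ (∈-filter⁻ (λ v → lem {Realized v}) {xs = allVectors (suc n)} (∈-lookup i))

  realized⇒W : ∀ {v} → Realized v → ∃[ i ] W i ≡ v
  realized⇒W r = Any.index v∈ , sym (lookup-index v∈)
    where
    v∈ : _ ∈ realizable
    v∈ = ∈-filter⁺ (λ v → lem {Realized v}) (∈-allVectors _) r

  values-compatible : ∀ Δ → Cluster Δ → ∀ k →
                      lookup (values Δ₀) k ≡ vN ⊎ lookup (values Δ₀) k ≡ lookup (values Δ) k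
  values-compatible Δ c k = Δ₀-compatible Δ c k _ _ (sym (lookup-values Δ₀ k)) (sym (lookup-values Δ k))

  W-compatible : ∀ i k → lookup (values Δ₀) k ≡ vN ⊎ lookup (values Δ₀) k ≡ lookup (W i) k
  W-compatible i k = let (Δ , c , e) = W-realized i in
    subst (λ v → lookup (values Δ₀) k ≡ vN ⊎ lookup (values Δ₀) k ≡ lookup v k) e (values-compatible Δ c k)

  open Realizers lem W (values Δ₀) W-compatible

  ⋆ : Realization
  ⋆ x = σ (indexOf xs x)

  choice-realized : ∀ x → Realized (maybe′ W (values Δ₀) x)
  choice-realized (just i) = W-realized i
  choice-realized nothing  = Δ₀ , Δ₀-cluster , refl

  outcome-realized : ∀ u → Realized (outcome u)
  outcome-realized u = choice-realized (scan (τ-value u) (length realizable))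

  world : FIX → World
  world u = proj₁ (outcome-realized u)

  world-cluster : ∀ u → Cluster (world u)
  world-cluster u = proj₁ (proj₂ (outcome-realized u))

  world-values : ∀ u → values (world u) ≡ outcome u
  world-values u = proj₂ (proj₂ (outcome-realized u))

  attained : ∀ Δ → Cluster Δ → Σ[ u ∈ FIX ] outcome u ≡ values Δ
  attained Δ c = let (i , Wi≡) = realized⇒W (Δ , c , refl) ; (u , e) = outcome-attains i in u , trans e Wi≡

  lookup-values-indexOf : ∀ {x} → x ∈V xs → ∀ Δ → lookup (values Δ) (indexOf xs x) ≡ value Δ x
  lookup-values-indexOf x∈ Δ = trans (lookup-values Δ _) (cong (value Δ) (lookup-indexOf xs x∈))

  atom-T : ∀ {x} → x ∈V xs → ∀ Δ → Δ ⊩ʷ T x ⇔ lookup (values Δ) (indexOf xs x) ≡ vT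
  atom-T {x} x∈ Δ = mk⇔ (λ ⊩T → trans (lookup-values-indexOf x∈ Δ) (from (value-T Δ x) ⊩T))
                        (λ e → to (value-T Δ x) (trans (sym (lookup-values-indexOf x∈ Δ)) e))

  atom-F : ∀ {x} → x ∈V xs → ∀ Δ → Δ ⊩ʷ F x ⇔ lookup (values Δ) (indexOf xs x) ≡ vF
  atom-F {x} x∈ Δ = mk⇔ (λ ⊩F → trans (lookup-values-indexOf x∈ Δ) (from (value-F Δ x) ⊩F))
                        (λ e → to (value-F Δ x) (trans (sym (lookup-values-indexOf x∈ Δ)) e))

  agree : ∀ {A} → A ⊑ φ → ∀ Δ Δ′ → Cluster Δ → Cluster Δ′ → values Δ ≡ values Δ′ → Δ ⊩ʷ A → Δ′ ⊩ʷ A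
  agree {T x} p Δ Δ′ c c′ e ⊩T =
    from (atom-T x∈ Δ′) (trans (cong (λ v → lookup v (indexOf xs x)) (sym e)) (to (atom-T x∈ Δ) ⊩T))
    where
    x∈ : x ∈V xs
    x∈ = vars x (⊑-Occurs p oT)
  agree {F x} p Δ Δ′ c c′ e ⊩F =
    from (atom-F x∈ Δ′) (trans (cong (λ v → lookup v (indexOf xs x)) (sym e)) (to (atom-F x∈ Δ) ⊩F))
    where
    x∈ : x ∈V xs
    x∈ = vars x (⊑-Occurs p oF)
  agree {¬' A} p Δ Δ′ c c′ e ⊩¬A =
    ⊩ʷ-¬ Δ′ (⊑φ⇒∈Rel (⊑-¬⁻ p)) (λ ⊩A → ⊩ʷ-consistent Δ (agree (⊑-¬⁻ p) Δ′ Δ c′ c (sym e) ⊩A) ⊩¬A)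
  agree {A ∧' B} p Δ Δ′ c c′ e ⊩A∧B =
    ⊢ᴸ-∧ (agree (⊑-∧ˡ⁻ p) Δ Δ′ c c′ e (⊢ᴸ-∧₁ ⊩A∧B)) (agree (⊑-∧ʳ⁻ p) Δ Δ′ c c′ e (⊢ᴸ-∧₂ ⊩A∧B))
  agree {□ A} p Δ Δ′ c c′ e ⊩□A = from (c′ (⊑φ⇒∈Rel p)) (to (c (⊑φ⇒∈Rel p)) ⊩□A)

  outcome⇔values : ∀ u k t → lookup (outcome u) k ≡ t ⇔ lookup (values (world u)) k ≡ t
  outcome⇔values u k t = mk⇔ (trans (cong (λ v → lookup v k) (world-values u)))
                             (trans (cong (λ v → lookup v k) (sym (world-values u))))

  truth : ∀ {A} → A ⊑ φ → ∀ u → ⋆ , u ⊩ A ⇔ world u ⊩ʷ A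
  truth {T x} p u = ⇔-sym (atom-T (vars x (⊑-Occurs p oT)) (world u))
                    ⇔-∘ (outcome⇔values u _ vT ⇔-∘ proj₁ (σ-HasValue u (indexOf xs x)))
  truth {F x} p u = ⇔-sym (atom-F (vars x (⊑-Occurs p oF)) (world u))
                    ⇔-∘ (outcome⇔values u _ vF ⇔-∘ proj₂ (σ-HasValue u (indexOf xs x)))
  truth {¬' A} p u = mk⇔
    (λ ⊮A → ⊩ʷ-¬ (world u) (⊑φ⇒∈Rel (⊑-¬⁻ p)) (⊮A ∘ from (truth (⊑-¬⁻ p) u)))
    (λ ⊩¬A ⊩A → ⊩ʷ-consistent (world u) (to (truth (⊑-¬⁻ p) u) ⊩A) ⊩¬A)
  truth {A ∧' B} p u = mk⇔
    (λ (⊩A , ⊩B) → ⊢ᴸ-∧ (to (truth (⊑-∧ˡ⁻ p) u) ⊩A) (to (truth (⊑-∧ʳ⁻ p) u) ⊩B))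
    (λ ⊩A∧B → from (truth (⊑-∧ˡ⁻ p) u) (⊢ᴸ-∧₁ ⊩A∧B) , from (truth (⊑-∧ʳ⁻ p) u) (⊢ᴸ-∧₂ ⊩A∧B))
  truth {□ A} p u = mk⇔ necessary boxed
    where
    everywhere : (∀ v → ⋆ , v ⊩ A) → ∀ Δ → Cluster Δ → Δ ⊩ʷ A
    everywhere ⊩A Δ c = let (v , e) = attained Δ c in
      agree (⊑-□⁻ p) (world v) Δ (world-cluster v) c (trans (world-values v) e) (to (truth (⊑-□⁻ p) v) (⊩A v))
    necessary : (∀ v → ⋆ , v ⊩ A) → world u ⊩ʷ □ A
    necessary ⊩A = from (world-cluster u (⊑φ⇒∈Rel p)) (□-intro Γ (⊑φ⇒∈Rel p) (everywhere ⊩A))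
    boxed : world u ⊩ʷ □ A → ∀ v → ⋆ , v ⊩ A
    boxed ⊩□A v = from (truth (⊑-□⁻ p) v)
      (□-elim {world v} {Γ} (⊑φ⇒∈Rel p) (world-cluster v) (to (world-cluster u (⊑φ⇒∈Rel p)) ⊩□A))

  refuted : ¬ FIX⊩ φ
  refuted ⊨φ = let (u , e) = attained Γ (SameBoxes-refl Γ) in
    ⊩ʷ-consistent Γ (agree ⊑-refl (world u) Γ (world-cluster u) (SameBoxes-refl Γ) (trans (world-values u) e)
                                  (to (truth ⊑-refl u) (⊨φ ⋆ u)))
                    Γ⊩¬φ

mainTheorem1 : ExcludedMiddle 0ℓ →
    (n : ℕ) → 1 ≤ n → (φ : MF) → AtMostVars n φ →
    (FIX⊩ φ → S5CGM n φ) × (S5CGM n φ → FIX⊩ φ)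
mainTheorem1 lem zero    ()
mainTheorem1 lem (suc n) _ φ (xs , vars) = completeness , Soundness.soundness lem
  where
  completeness : FIX⊩ φ → S5CGM (suc n) φ
  completeness ⊨φ = em⇒dne lem (λ ⊬φ → Completeness.refuted lem φ xs vars ⊬φ ⊨φ)
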